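{- Let $k>1$ and let $P(T,\mathbf{x},z)\in\mathbb{F}[T,\mathbf{x},z]$, $R(T,\mathbf{x})\in\mathbb{F}[T,\mathbf{x}]$ with $\mathbf{x}=(x_1,\dots,x_n)$, such that $P$ is $T$-regularized and monic in $z$, and $R$ is a truncated, non-degenerate, approximate $z$-root of $P$ of order $k$. Let $\mathbf{w}$ be a tuple of $\mu$ new variables, $h_1,\dots,h_n\in\mathbb{F}[\mathbf{w}]$, $\gamma\in\mathbb{F}\setminus\{0\}$, and let $\Lambda:\mathbb{F}[T,\mathbf{x},z]\to\mathbb{F}[T,\mathbf{w},z]$ be the ring homomorphism with $T\mapsto\gamma T$, $x_i\mapsto h_i(\mathbf{w})$, $z\mapsto z$. Then: (1) $\Lambda(R)(0,\mathbf{w})=R(0,\mathbf{x})\in\mathbb{F}$; (2) $\Lambda(P)(T,\mathbf{w},z)$ is $T$-regularized and monic in $z$; (3) $\Lambda(R)(T,\mathbf{w})$ is a truncated, non-degenerate, approximate $z$-root of $\Lambda(P)(T,\mathbf{w},z)$ of order $k$.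
   Context: Monic in $z$: the coefficient of the highest power of $z$ is a nonzero field constant. $P$ is $T$-regularized if $P(0,\mathbf{x},z)\in\mathbb{F}[z]$. $R$ is an approximate $z$-root of $P$ of order $k$ (with respect to $T$) if $P(T,\mathbf{x},R(T,\mathbf{x}))\equiv0\bmod T^k$; truncated if $\deg_TR<k$; non-degenerate if $(\partial_zP)(0,\mathbf{0},R(0,\mathbf{0}))\ne0$. -}

module Defs where

open import Level using (Level; _⊔_)
open import Algebra.Bundles using (CommutativeRing)
open import Data.Nat as ℕ using (ℕ; zero; suc; _<_; _≤_)
open import Data.Fin using (Fin; zero; suc)
open import Data.List using (List; []; _∷_)
open import Data.Product using (Σ; ∃; _×_; _,_)
open import Data.Unit.Polymorphic using (⊤)
open import Relation.Nullary using (¬_)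

record Field (c ℓ : Level) : Set (Level.suc (c ⊔ ℓ)) where
  field
    commutativeRing : CommutativeRing c ℓ
  open CommutativeRing commutativeRing public
  field
    0≉1     : ¬ (0# ≈ 1#)
    inverse : ∀ x → ¬ (x ≈ 0#) → ∃ λ y → x * y ≈ 1#

-- Multivariate polynomials over a field F in m variables, represented
-- recursively: MPoly 0 = F, MPoly (suc m) = (MPoly m)[y₀], a list of
-- coefficients (lowest degree first) in the outermost variable y₀;
-- the variable with index (suc i) of MPoly (suc m) is variable i of
-- the coefficient ring MPoly m.

module Poly {c ℓ} (F : Field c ℓ) where
  open Field F public using (Carrier; _≈_; _+_; _*_; 0#; 1#)

  data MPoly : ℕ → Set c where
    κ   : Carrier → MPoly zero
    ⟨_⟩ : ∀ {m} → List (MPoly m) → MPoly (suc m)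

  zeroP : ∀ {m} → MPoly m
  zeroP {zero}  = κ 0#
  zeroP {suc m} = ⟨ [] ⟩

  const : ∀ {m} → Carrier → MPoly m
  const {zero}  a = κ a
  const {suc m} a = ⟨ const a ∷ [] ⟩

  oneP : ∀ {m} → MPoly m
  oneP = const 1#

  -- equality of polynomials (coefficientwise, ignoring trailing zeros)
  infix 4 _≋_ _≋L_
  _≋_  : ∀ {m} → MPoly m → MPoly m → Set ℓ
  _≋L_ : ∀ {m} → List (MPoly m) → List (MPoly m) → Set ℓ
  κ a   ≋ κ b   = a ≈ b
  ⟨ p ⟩ ≋ ⟨ q ⟩ = p ≋L q
  []       ≋L []       = ⊤
  []       ≋L (b ∷ bs) = (b ≋ zeroP) × ([] ≋L bs)
  (a ∷ as) ≋L []       = (a ≋ zeroP) × (as ≋L [])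
  (a ∷ as) ≋L (b ∷ bs) = (a ≋ b) × (as ≋L bs)

  infixl 6 _+P_ _+L_
  infixl 7 _*P_
  _+P_ : ∀ {m} → MPoly m → MPoly m → MPoly m
  _+L_ : ∀ {m} → List (MPoly m) → List (MPoly m) → List (MPoly m)
  κ a   +P κ b   = κ (a + b)
  ⟨ p ⟩ +P ⟨ q ⟩ = ⟨ p +L q ⟩
  []       +L bs       = bs
  (a ∷ as) +L []       = a ∷ as
  (a ∷ as) +L (b ∷ bs) = (a +P b) ∷ (as +L bs)

  _*P_   : ∀ {m} → MPoly m → MPoly m → MPoly m
  _*L_   : ∀ {m} → List (MPoly m) → List (MPoly m) → List (MPoly m)
  scaleL : ∀ {m} → MPoly m → List (MPoly m) → List (MPoly m)
  κ a   *P κ b   = κ (a * b)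
  ⟨ p ⟩ *P ⟨ q ⟩ = ⟨ p *L q ⟩
  []       *L bs = []
  (a ∷ as) *L bs = scaleL a bs +L (zeroP ∷ (as *L bs))
  scaleL a []       = []
  scaleL a (b ∷ bs) = (a *P b) ∷ scaleL a bs

  infixr 8 _^P_
  _^P_ : ∀ {m} → MPoly m → ℕ → MPoly m
  p ^P zero    = oneP
  p ^P (suc k) = p *P (p ^P k)

  var : ∀ {m} → Fin m → MPoly m
  var {suc m} zero    = ⟨ zeroP ∷ oneP ∷ [] ⟩
  var {suc m} (suc i) = ⟨ var i ∷ [] ⟩

  subst  : ∀ {m m'} → (Fin m → MPoly m') → MPoly m → MPoly m'
  substL : ∀ {m m'} → (Fin (suc m) → MPoly m') → List (MPoly m) → MPoly m'
  subst σ (κ a)   = const a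
  subst σ ⟨ as ⟩  = substL σ as
  substL σ []       = zeroP
  substL σ (a ∷ as) = subst (λ i → σ (suc i)) a +P (σ zero *P substL σ as)

  coeffL : ∀ {m} → List (MPoly m) → ℕ → MPoly m
  coeffL []       j       = zeroP
  coeffL (a ∷ as) zero    = a
  coeffL (a ∷ as) (suc j) = coeffL as j

  coeff : ∀ {m} → MPoly (suc m) → ℕ → MPoly m
  coeff ⟨ as ⟩ j = coeffL as j

  natF : ℕ → Carrier
  natF zero    = 0#
  natF (suc n) = 1# + natF n

  derivFrom : ∀ {m} → ℕ → List (MPoly m) → List (MPoly m)
  derivFrom i []       = []
  derivFrom i (b ∷ bs) = (const (natF i) *P b) ∷ derivFrom (suc i) bs

  ∂₀ : ∀ {m} → MPoly (suc m) → MPoly (suc m)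
  ∂₀ ⟨ [] ⟩     = ⟨ [] ⟩
  ∂₀ ⟨ a ∷ as ⟩ = ⟨ derivFrom 1 as ⟩

  -- For x = (x₁,…,xₙ):
  --   F[T,x]   = MPoly (suc n)        with T = var 0, xᵢ = var (suc i)
  --   F[T,x,z] = MPoly (suc (suc n))  with z = var 0, T = var 1,
  --                                   xᵢ = var (suc (suc i))
  -- (so an element of F[T,x,z] is a polynomial in z with coefficients
  --  in F[T,x]).

  atT0z : ∀ {n} → Fin (suc (suc n)) → MPoly (suc (suc n))
  atT0z zero          = var zero
  atT0z (suc zero)    = zeroP
  atT0z (suc (suc i)) = var (suc (suc i))

  ιz : ∀ {n} → Fin 1 → MPoly (suc (suc n))
  ιz zero = var zero

  TRegularized : ∀ {n} → MPoly (suc (suc n)) → Set (c ⊔ ℓ)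
  TRegularized P = ∃ λ (q : MPoly 1) → subst atT0z P ≋ subst ιz q

  MonicZ : ∀ {n} → MPoly (suc (suc n)) → Set (c ⊔ ℓ)
  MonicZ P = ∃ λ (d : ℕ) → ∃ λ (a : Carrier) →
    ¬ (a ≈ 0#) × (coeff P d ≋ const a) × (∀ i → d < i → coeff P i ≋ zeroP)

  plugZ : ∀ {n} → MPoly (suc n) → Fin (suc (suc n)) → MPoly (suc n)
  plugZ R zero    = R
  plugZ R (suc i) = var i

  ApproxRoot : ∀ {n} → MPoly (suc (suc n)) → MPoly (suc n) → ℕ → Set (c ⊔ ℓ)
  ApproxRoot P R k =
    ∃ λ (Q : MPoly _) → subst (plugZ R) P ≋ (var zero ^P k) *P Q

  Truncated : ∀ {n} → MPoly (suc n) → ℕ → Set ℓ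
  Truncated R k = ∀ j → k ≤ j → coeff R j ≋ zeroP

  unκ : MPoly zero → Carrier
  unκ (κ a) = a

  at0 : ∀ {m} → MPoly m → Carrier
  at0 p = unκ (subst (λ _ → κ 0#) p)

  evalAt : ∀ {n} → Carrier → Fin (suc (suc n)) → MPoly zero
  evalAt r zero    = κ r
  evalAt r (suc i) = κ 0#

  NonDegenerate : ∀ {n} → MPoly (suc (suc n)) → MPoly (suc n) → Set ℓ
  NonDegenerate P R = ¬ (unκ (subst (evalAt (at0 R)) (∂₀ P)) ≈ 0#)

  TNDApproxRoot : ∀ {n} → MPoly (suc (suc n)) → MPoly (suc n) → ℕ → Set (c ⊔ ℓ)
  TNDApproxRoot P R k = Truncated R k × NonDegenerate P R × ApproxRoot P R k

  atT0 : ∀ {n} → Fin (suc n) → MPoly (suc n)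
  atT0 zero    = zeroP
  atT0 (suc i) = var (suc i)

  ΛTxzσ : ∀ {n μ} → (Fin n → MPoly μ) → Carrier →
          Fin (suc (suc n)) → MPoly (suc (suc μ))
  ΛTxzσ h γ zero          = var zero
  ΛTxzσ h γ (suc zero)    = const γ *P var (suc zero)
  ΛTxzσ h γ (suc (suc i)) = subst (λ j → var (suc (suc j))) (h i)

  ΛTxz : ∀ {n μ} → (Fin n → MPoly μ) → Carrier →
         MPoly (suc (suc n)) → MPoly (suc (suc μ))
  ΛTxz h γ = subst (ΛTxzσ h γ)

  ΛTxσ : ∀ {n μ} → (Fin n → MPoly μ) → Carrier →
         Fin (suc n) → MPoly (suc μ)
  ΛTxσ h γ zero    = const γ *P var zero
  ΛTxσ h γ (suc i) = subst (λ j → var (suc j)) (h i)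

  ΛTx : ∀ {n μ} → (Fin n → MPoly μ) → Carrier →
        MPoly (suc n) → MPoly (suc μ)
  ΛTx h γ = subst (ΛTxσ h γ)

module Submission where

-- Parts (2) and (3) are functoriality of the substitution Λ: it commutes with setting
-- T = 0 and with plugging in z = R, acts on P coefficientwise in z, and multiplies the
-- coefficient of Tʲ in R by γʲ.  For (1), T-regularity makes every z-coefficient of P
-- constant at T = 0, so P(0, x, z) = q(z) with q ∈ F[z], and q(R(0, x)) = 0 since k ≥ 1.
-- Writing R(0, x) = r + S with S(0) = 0, the Taylor expansion q(r + S) = q(r) + S·D has
-- D(0) = q′(r) = ∂_z P(0, 0, r) ≠ 0; evaluating at 0 gives q(r) = 0, hence S·D = 0, and
-- S = 0 because D(0) ≠ 0 makes D a non-zero-divisor.  With R(0, x) = r constant,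
-- Λ(R)(0, w) = r and Λ leaves the value ∂_z P(0, 0, r) unchanged.

open import Defs
open import Data.Nat using (ℕ; zero; suc; _<_)
open import Data.Fin using (Fin; zero; suc)
open import Data.Product using (∃; _×_; _,_)
open import Relation.Nullary using (¬_)
open import Algebra.Bundles using (CommutativeSemiring)
import Algebra.Properties.CommutativeSemigroup as CommutativeSemigroupProperties
import Algebra.Solver.Ring.NaturalCoefficients.Default as Solver
open import Algebra.Structures using (IsCommutativeSemiring)
open import Algebra.Structures.Biased using (IsCommutativeSemiringˡ)
open import Data.Empty using (⊥-elim)
open import Data.List using (List; []; _∷_; map)
open import Data.List.Relation.Binary.Pointwise as Pointwise using (Pointwise; []; _∷_)
open import Data.List.Relation.Unary.All using (All; []; _∷_)
open import Data.Unit.Polymorphic using (⊤; tt)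
open import Function using (_∘_)
open import Level using (_⊔_)
open import Relation.Binary.Structures using (IsEquivalence)
import Relation.Binary.PropositionalEquality as ≡
open ≡ using (_≡_)
import Relation.Binary.Reasoning.Setoid as SetoidReasoning

module CoefficientList {c ℓ} (S : CommutativeSemiring c ℓ) where
  open CommutativeSemiring S renaming (Carrier to A)

  infix 4 _≈ₗ_
  infixl 6 _⊕_
  infixl 7 _⊗_

  Equal : List A → List A → Set ℓ
  Equal []       []       = ⊤
  Equal []       (b ∷ bs) = (b ≈ 0#) × Equal [] bs
  Equal (a ∷ as) []       = (a ≈ 0#) × Equal as []
  Equal (a ∷ as) (b ∷ bs) = (a ≈ b) × Equal as bs

  -- A record, so that both lists can be inferred from an equality proof.
  record _≈ₗ_ (xs ys : List A) : Set ℓ where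
    constructor ⟪_⟫
    field equal : Equal xs ys
  open _≈ₗ_ public

  []≈[] : [] ≈ₗ []
  []≈[] = ⟪ tt ⟫

  ∷-cong : ∀ {a b as bs} → a ≈ b → as ≈ₗ bs → a ∷ as ≈ₗ b ∷ bs
  ∷-cong p ⟪ q ⟫ = ⟪ p , q ⟫

  ∷≈[] : ∀ {a as} → a ≈ 0# → as ≈ₗ [] → a ∷ as ≈ₗ []
  ∷≈[] p ⟪ q ⟫ = ⟪ p , q ⟫

  []≈∷ : ∀ {b bs} → b ≈ 0# → [] ≈ₗ bs → [] ≈ₗ b ∷ bs
  []≈∷ p ⟪ q ⟫ = ⟪ p , q ⟫

  ∷-injectiveˡ : ∀ {a b as bs} → a ∷ as ≈ₗ b ∷ bs → a ≈ b
  ∷-injectiveˡ ⟪ p , _ ⟫ = p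

  ∷-injectiveʳ : ∀ {a b as bs} → a ∷ as ≈ₗ b ∷ bs → as ≈ₗ bs
  ∷-injectiveʳ ⟪ _ , q ⟫ = ⟪ q ⟫

  ∷≈[]-head : ∀ {a as} → a ∷ as ≈ₗ [] → a ≈ 0#
  ∷≈[]-head ⟪ p , _ ⟫ = p

  ∷≈[]-tail : ∀ {a as} → a ∷ as ≈ₗ [] → as ≈ₗ []
  ∷≈[]-tail ⟪ _ , q ⟫ = ⟪ q ⟫

  []≈∷-head : ∀ {b bs} → [] ≈ₗ b ∷ bs → b ≈ 0#
  []≈∷-head ⟪ p , _ ⟫ = p

  []≈∷-tail : ∀ {b bs} → [] ≈ₗ b ∷ bs → [] ≈ₗ bs
  []≈∷-tail ⟪ _ , q ⟫ = ⟪ q ⟫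

  _⊕_ : List A → List A → List A
  []       ⊕ bs       = bs
  (a ∷ as) ⊕ []       = a ∷ as
  (a ∷ as) ⊕ (b ∷ bs) = (a + b) ∷ (as ⊕ bs)

  scale : A → List A → List A
  scale a []       = []
  scale a (b ∷ bs) = a * b ∷ scale a bs

  _⊗_ : List A → List A → List A
  []       ⊗ bs = []
  (a ∷ as) ⊗ bs = scale a bs ⊕ (0# ∷ (as ⊗ bs))

  ≈ₗ-refl : ∀ {xs} → xs ≈ₗ xs
  ≈ₗ-refl {[]}     = []≈[]
  ≈ₗ-refl {x ∷ xs} = ∷-cong refl ≈ₗ-refl

  ≈ₗ-reflexive : ∀ {xs ys} → xs ≡ ys → xs ≈ₗ ys
  ≈ₗ-reflexive ≡.refl = ≈ₗ-refl

  ≈ₗ-sym : ∀ {xs ys} → xs ≈ₗ ys → ys ≈ₗ xs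
  ≈ₗ-sym {[]}     {[]}     _ = []≈[]
  ≈ₗ-sym {[]}     {y ∷ ys} p = ∷≈[] ([]≈∷-head p) (≈ₗ-sym ([]≈∷-tail p))
  ≈ₗ-sym {x ∷ xs} {[]}     p = []≈∷ (∷≈[]-head p) (≈ₗ-sym (∷≈[]-tail p))
  ≈ₗ-sym {x ∷ xs} {y ∷ ys} p = ∷-cong (sym (∷-injectiveˡ p)) (≈ₗ-sym (∷-injectiveʳ p))

  ≈ₗ-trans : ∀ {xs ys zs} → xs ≈ₗ ys → ys ≈ₗ zs → xs ≈ₗ zs
  ≈ₗ-trans {[]}     {[]}              p q = q
  ≈ₗ-trans {[]}     {y ∷ ys} {[]}     p q = []≈[]
  ≈ₗ-trans {[]}     {y ∷ ys} {z ∷ zs} p q =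
    []≈∷ (trans (sym (∷-injectiveˡ q)) ([]≈∷-head p)) (≈ₗ-trans ([]≈∷-tail p) (∷-injectiveʳ q))
  ≈ₗ-trans {x ∷ xs} {[]}     {[]}     p q = p
  ≈ₗ-trans {x ∷ xs} {[]}     {z ∷ zs} p q =
    ∷-cong (trans (∷≈[]-head p) (sym ([]≈∷-head q))) (≈ₗ-trans (∷≈[]-tail p) ([]≈∷-tail q))
  ≈ₗ-trans {x ∷ xs} {y ∷ ys} {[]}     p q =
    ∷≈[] (trans (∷-injectiveˡ p) (∷≈[]-head q)) (≈ₗ-trans (∷-injectiveʳ p) (∷≈[]-tail q))
  ≈ₗ-trans {x ∷ xs} {y ∷ ys} {z ∷ zs} p q =
    ∷-cong (trans (∷-injectiveˡ p) (∷-injectiveˡ q)) (≈ₗ-trans (∷-injectiveʳ p) (∷-injectiveʳ q))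

  ≈ₗ-isEquivalence : IsEquivalence _≈ₗ_
  ≈ₗ-isEquivalence = record { refl = ≈ₗ-refl ; sym = ≈ₗ-sym ; trans = ≈ₗ-trans }

  ⊕-identityʳ : ∀ xs → xs ⊕ [] ≡ xs
  ⊕-identityʳ []       = ≡.refl
  ⊕-identityʳ (x ∷ xs) = ≡.refl

  ⊕-comm : ∀ xs ys → xs ⊕ ys ≈ₗ ys ⊕ xs
  ⊕-comm []       []       = []≈[]
  ⊕-comm []       (y ∷ ys) = ≈ₗ-refl
  ⊕-comm (x ∷ xs) []       = ≈ₗ-refl
  ⊕-comm (x ∷ xs) (y ∷ ys) = ∷-cong (+-comm x y) (⊕-comm xs ys)

  ⊕-assoc : ∀ xs ys zs → (xs ⊕ ys) ⊕ zs ≈ₗ xs ⊕ (ys ⊕ zs)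
  ⊕-assoc []       ys       zs       = ≈ₗ-refl
  ⊕-assoc (x ∷ xs) []       zs       = ≈ₗ-refl
  ⊕-assoc (x ∷ xs) (y ∷ ys) []       = ≈ₗ-refl
  ⊕-assoc (x ∷ xs) (y ∷ ys) (z ∷ zs) = ∷-cong (+-assoc x y z) (⊕-assoc xs ys zs)

  ⊕-congʳ : ∀ {xs xs'} ys → xs ≈ₗ xs' → xs ⊕ ys ≈ₗ xs' ⊕ ys
  ⊕-congʳ {[]}     {[]}     ys       p = ≈ₗ-refl
  ⊕-congʳ {[]}     {b ∷ bs} []       p = p
  ⊕-congʳ {[]}     {b ∷ bs} (y ∷ ys) p =
    ∷-cong (trans (sym (+-identityˡ y)) (+-congʳ (sym ([]≈∷-head p)))) (⊕-congʳ ys ([]≈∷-tail p))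
  ⊕-congʳ {x ∷ xs} {[]}     []       p = p
  ⊕-congʳ {x ∷ xs} {[]}     (y ∷ ys) p =
    ∷-cong (trans (+-congʳ (∷≈[]-head p)) (+-identityˡ y)) (⊕-congʳ {xs} {[]} ys (∷≈[]-tail p))
  ⊕-congʳ {x ∷ xs} {b ∷ bs} []       p = p
  ⊕-congʳ {x ∷ xs} {b ∷ bs} (y ∷ ys) p = ∷-cong (+-congʳ (∷-injectiveˡ p)) (⊕-congʳ ys (∷-injectiveʳ p))

  ⊕-cong : ∀ {xs xs' ys ys'} → xs ≈ₗ xs' → ys ≈ₗ ys' → xs ⊕ ys ≈ₗ xs' ⊕ ys'
  ⊕-cong {xs} {xs'} {ys} {ys'} p q =
    ≈ₗ-trans (⊕-congʳ ys p) (≈ₗ-trans (⊕-comm xs' ys)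
      (≈ₗ-trans (⊕-congʳ xs' q) (⊕-comm ys' xs')))

  ⊕-zeroʳ : ∀ xs {zs} → zs ≈ₗ [] → xs ⊕ zs ≈ₗ xs
  ⊕-zeroʳ xs {zs} p = ≈ₗ-trans (⊕-comm xs zs) (⊕-congʳ xs p)

  ⊕-interchange : ∀ as bs cs ds → (as ⊕ bs) ⊕ (cs ⊕ ds) ≈ₗ (as ⊕ cs) ⊕ (bs ⊕ ds)
  ⊕-interchange as bs cs ds = ≈ₗ-trans (⊕-assoc as bs (cs ⊕ ds))
    (≈ₗ-trans (⊕-cong (≈ₗ-refl {as}) middle) (≈ₗ-sym (⊕-assoc as cs (bs ⊕ ds))))
    where
    middle : bs ⊕ (cs ⊕ ds) ≈ₗ cs ⊕ (bs ⊕ ds)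
    middle = ≈ₗ-trans (≈ₗ-sym (⊕-assoc bs cs ds))
      (≈ₗ-trans (⊕-congʳ ds (⊕-comm bs cs)) (⊕-assoc cs bs ds))

  scale-≈[] : ∀ a {xs} → xs ≈ₗ [] → scale a xs ≈ₗ []
  scale-≈[] a {[]}     p = []≈[]
  scale-≈[] a {x ∷ xs} p = ∷≈[] (trans (*-congˡ (∷≈[]-head p)) (zeroʳ a)) (scale-≈[] a (∷≈[]-tail p))

  scale-cong : ∀ {a a' xs xs'} → a ≈ a' → xs ≈ₗ xs' → scale a xs ≈ₗ scale a' xs'
  scale-cong {xs = []}     {[]}              e p = []≈[]
  scale-cong {a' = a'} {xs = []} {y ∷ ys}    e p = ≈ₗ-sym (scale-≈[] a' (≈ₗ-sym p))
  scale-cong {a} {xs = x ∷ xs} {[]}          e p = scale-≈[] a p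
  scale-cong {xs = x ∷ xs} {y ∷ ys}          e p = ∷-cong (*-cong e (∷-injectiveˡ p)) (scale-cong e (∷-injectiveʳ p))

  scale-⊕ : ∀ a xs ys → scale a (xs ⊕ ys) ≈ₗ scale a xs ⊕ scale a ys
  scale-⊕ a []       ys       = ≈ₗ-refl
  scale-⊕ a (x ∷ xs) []       = ≈ₗ-refl
  scale-⊕ a (x ∷ xs) (y ∷ ys) = ∷-cong (distribˡ a x y) (scale-⊕ a xs ys)

  scale-+ : ∀ a b xs → scale (a + b) xs ≈ₗ scale a xs ⊕ scale b xs
  scale-+ a b []       = []≈[]
  scale-+ a b (x ∷ xs) = ∷-cong (distribʳ x a b) (scale-+ a b xs)

  scale-* : ∀ a b xs → scale (a * b) xs ≈ₗ scale a (scale b xs)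
  scale-* a b []       = []≈[]
  scale-* a b (x ∷ xs) = ∷-cong (*-assoc a b x) (scale-* a b xs)

  scale-0 : ∀ xs → scale 0# xs ≈ₗ []
  scale-0 []       = []≈[]
  scale-0 (x ∷ xs) = ∷≈[] (zeroˡ x) (scale-0 xs)

  scale-1 : ∀ xs → scale 1# xs ≈ₗ xs
  scale-1 []       = []≈[]
  scale-1 (x ∷ xs) = ∷-cong (*-identityˡ x) (scale-1 xs)

  ⊗-zeroʳ : ∀ xs → xs ⊗ [] ≈ₗ []
  ⊗-zeroʳ []       = []≈[]
  ⊗-zeroʳ (x ∷ xs) = ∷≈[] refl (⊗-zeroʳ xs)

  ⊗-≈[]ˡ : ∀ {xs} ys → xs ≈ₗ [] → xs ⊗ ys ≈ₗ []
  ⊗-≈[]ˡ {[]}     ys p = []≈[]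
  ⊗-≈[]ˡ {x ∷ xs} ys p =
    ≈ₗ-trans (⊕-congʳ (0# ∷ (xs ⊗ ys)) (≈ₗ-trans (scale-cong (∷≈[]-head p) ≈ₗ-refl) (scale-0 ys)))
             (∷≈[] refl (⊗-≈[]ˡ ys (∷≈[]-tail p)))

  ⊗-congʳ : ∀ {xs xs'} ys → xs ≈ₗ xs' → xs ⊗ ys ≈ₗ xs' ⊗ ys
  ⊗-congʳ {[]}     {[]}     ys p = []≈[]
  ⊗-congʳ {[]}     {b ∷ bs} ys p = ≈ₗ-sym (⊗-≈[]ˡ ys (≈ₗ-sym p))
  ⊗-congʳ {x ∷ xs} {[]}     ys p = ⊗-≈[]ˡ ys p
  ⊗-congʳ {x ∷ xs} {b ∷ bs} ys p =
    ⊕-cong (scale-cong (∷-injectiveˡ p) ≈ₗ-refl) (∷-cong refl (⊗-congʳ ys (∷-injectiveʳ p)))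

  ⊗-congˡ : ∀ xs {ys ys'} → ys ≈ₗ ys' → xs ⊗ ys ≈ₗ xs ⊗ ys'
  ⊗-congˡ []       p = []≈[]
  ⊗-congˡ (x ∷ xs) p = ⊕-cong (scale-cong refl p) (∷-cong refl (⊗-congˡ xs p))

  ⊗-cong : ∀ {xs xs' ys ys'} → xs ≈ₗ xs' → ys ≈ₗ ys' → xs ⊗ ys ≈ₗ xs' ⊗ ys'
  ⊗-cong {xs} {xs'} {ys} p q = ≈ₗ-trans (⊗-congʳ ys p) (⊗-congˡ xs' q)

  ⊗-distribʳ : ∀ xs ys zs → (xs ⊕ ys) ⊗ zs ≈ₗ xs ⊗ zs ⊕ ys ⊗ zs
  ⊗-distribʳ []       ys       zs = ≈ₗ-refl
  ⊗-distribʳ (x ∷ xs) []       zs = ≈ₗ-sym (≈ₗ-reflexive (⊕-identityʳ ((x ∷ xs) ⊗ zs)))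
  ⊗-distribʳ (x ∷ xs) (y ∷ ys) zs =
    ≈ₗ-trans (⊕-cong (scale-+ x y zs)
               (∷-cong (sym (+-identityˡ 0#)) (⊗-distribʳ xs ys zs)))
             (⊕-interchange (scale x zs) (scale y zs) (0# ∷ (xs ⊗ zs)) (0# ∷ (ys ⊗ zs)))

  scale-⊗ : ∀ a xs ys → scale a xs ⊗ ys ≈ₗ scale a (xs ⊗ ys)
  scale-⊗ a []       ys = []≈[]
  scale-⊗ a (x ∷ xs) ys =
    ≈ₗ-trans (⊕-cong (scale-* a x ys) (∷-cong (sym (zeroʳ a)) (scale-⊗ a xs ys)))
             (≈ₗ-sym (scale-⊕ a (scale x ys) (0# ∷ (xs ⊗ ys))))

  0∷-⊗ : ∀ xs ys → (0# ∷ xs) ⊗ ys ≈ₗ 0# ∷ (xs ⊗ ys)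
  0∷-⊗ xs ys = ⊕-congʳ (0# ∷ (xs ⊗ ys)) (scale-0 ys)

  ⊗-assoc : ∀ xs ys zs → (xs ⊗ ys) ⊗ zs ≈ₗ xs ⊗ (ys ⊗ zs)
  ⊗-assoc []       ys zs = []≈[]
  ⊗-assoc (x ∷ xs) ys zs =
    ≈ₗ-trans (⊗-distribʳ (scale x ys) (0# ∷ (xs ⊗ ys)) zs)
      (⊕-cong (scale-⊗ x ys zs)
        (≈ₗ-trans (0∷-⊗ (xs ⊗ ys) zs) (∷-cong refl (⊗-assoc xs ys zs))))

  ⊗-∷ : ∀ xs b bs → xs ⊗ (b ∷ bs) ≈ₗ scale b xs ⊕ (0# ∷ (xs ⊗ bs))
  ⊗-∷ []       b bs = []≈∷ refl []≈[]
  ⊗-∷ (a ∷ as) b bs =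
    ∷-cong (+-congʳ (*-comm a b))
      (≈ₗ-trans (⊕-cong ≈ₗ-refl (⊗-∷ as b bs)) (swap (scale a bs) (scale b as) (0# ∷ (as ⊗ bs))))
    where
    swap : ∀ xs ys zs → xs ⊕ (ys ⊕ zs) ≈ₗ ys ⊕ (xs ⊕ zs)
    swap xs ys zs = ≈ₗ-trans (≈ₗ-sym (⊕-assoc xs ys zs))
      (≈ₗ-trans (⊕-congʳ zs (⊕-comm xs ys)) (⊕-assoc ys xs zs))

  ⊗-comm : ∀ xs ys → xs ⊗ ys ≈ₗ ys ⊗ xs
  ⊗-comm []       ys = ≈ₗ-sym (⊗-zeroʳ ys)
  ⊗-comm (x ∷ xs) ys =
    ≈ₗ-trans (⊕-cong ≈ₗ-refl (∷-cong refl (⊗-comm xs ys))) (≈ₗ-sym (⊗-∷ ys x xs))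

  ⊗-identityˡ : ∀ xs → (1# ∷ []) ⊗ xs ≈ₗ xs
  ⊗-identityˡ xs = ≈ₗ-trans (⊕-congʳ (0# ∷ []) (scale-1 xs)) (⊕-zeroʳ xs (∷≈[] refl []≈[]))

  ⊕-⊗-isCommutativeSemiring : IsCommutativeSemiring _≈ₗ_ _⊕_ _⊗_ [] (1# ∷ [])
  ⊕-⊗-isCommutativeSemiring = IsCommutativeSemiringˡ.isCommutativeSemiring record
    { +-isCommutativeMonoid = record
      { isMonoid = record
        { isSemigroup = record
          { isMagma = record { isEquivalence = ≈ₗ-isEquivalence ; ∙-cong = ⊕-cong }
          ; assoc = ⊕-assoc }
        ; identity = (λ _ → ≈ₗ-refl) , (λ xs → ≈ₗ-reflexive (⊕-identityʳ xs)) }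
      ; comm = ⊕-comm }
    ; *-isCommutativeMonoid = record
      { isMonoid = record
        { isSemigroup = record
          { isMagma = record { isEquivalence = ≈ₗ-isEquivalence ; ∙-cong = ⊗-cong }
          ; assoc = ⊗-assoc }
        ; identity = ⊗-identityˡ , (λ xs → ≈ₗ-trans (⊗-comm xs (1# ∷ [])) (⊗-identityˡ xs)) }
      ; comm = ⊗-comm }
    ; distribʳ = λ x y z → ⊗-distribʳ y z x
    ; zeroˡ = λ _ → []≈[] }

module PolynomialSemiring {c ℓ} (F : Field c ℓ) where
  open Poly F
  private module 𝔽 = Field F

  -- A record for the same reason as _≈ₗ_.
  infix 4 _≈ₚ_
  record _≈ₚ_ {m : ℕ} (p q : MPoly m) : Set ℓ where
    constructor ⟦_⟧
    field ≋-proof : p ≋ q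
  open _≈ₚ_ public

  IsMPolySemiring : ℕ → Set (c ⊔ ℓ)
  IsMPolySemiring m = IsCommutativeSemiring (_≈ₚ_ {m}) _+P_ _*P_ zeroP oneP

  toSemiring : ∀ m → IsMPolySemiring m → CommutativeSemiring c ℓ
  toSemiring m isSemiring = record { isCommutativeSemiring = isSemiring }

  constants-isSemiring : IsMPolySemiring zero
  constants-isSemiring = IsCommutativeSemiringˡ.isCommutativeSemiring record
    { +-isCommutativeMonoid = record
      { isMonoid = record
        { isSemigroup = record
          { isMagma = record { isEquivalence = isEquivalence ; ∙-cong = +-cong }
          ; assoc = λ { (κ a) (κ b) (κ d) → ⟦ 𝔽.+-assoc a b d ⟧ } }
        ; identity = (λ { (κ a) → ⟦ 𝔽.+-identityˡ a ⟧ }) , (λ { (κ a) → ⟦ 𝔽.+-identityʳ a ⟧ }) }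
      ; comm = λ { (κ a) (κ b) → ⟦ 𝔽.+-comm a b ⟧ } }
    ; *-isCommutativeMonoid = record
      { isMonoid = record
        { isSemigroup = record
          { isMagma = record { isEquivalence = isEquivalence ; ∙-cong = *-cong }
          ; assoc = λ { (κ a) (κ b) (κ d) → ⟦ 𝔽.*-assoc a b d ⟧ } }
        ; identity = (λ { (κ a) → ⟦ 𝔽.*-identityˡ a ⟧ }) , (λ { (κ a) → ⟦ 𝔽.*-identityʳ a ⟧ }) }
      ; comm = λ { (κ a) (κ b) → ⟦ 𝔽.*-comm a b ⟧ } }
    ; distribʳ = λ { (κ a) (κ b) (κ d) → ⟦ 𝔽.distribʳ a b d ⟧ }
    ; zeroˡ = λ { (κ a) → ⟦ 𝔽.zeroˡ a ⟧ } }
    where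
    isEquivalence : IsEquivalence (_≈ₚ_ {zero})
    isEquivalence = record
      { refl  = λ { {κ a} → ⟦ 𝔽.refl ⟧ }
      ; sym   = λ { {κ a} {κ b} ⟦ p ⟧ → ⟦ 𝔽.sym p ⟧ }
      ; trans = λ { {κ a} {κ b} {κ d} ⟦ p ⟧ ⟦ q ⟧ → ⟦ 𝔽.trans p q ⟧ } }
    +-cong : ∀ {x y u v : MPoly zero} → x ≈ₚ y → u ≈ₚ v → x +P u ≈ₚ y +P v
    +-cong {κ a} {κ b} {κ d} {κ e} ⟦ p ⟧ ⟦ q ⟧ = ⟦ 𝔽.+-cong p q ⟧
    *-cong : ∀ {x y u v : MPoly zero} → x ≈ₚ y → u ≈ₚ v → x *P u ≈ₚ y *P v
    *-cong {κ a} {κ b} {κ d} {κ e} ⟦ p ⟧ ⟦ q ⟧ = ⟦ 𝔽.*-cong p q ⟧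

  -- MPoly (suc m) is the coefficient-list semiring over MPoly m, up to the
  -- (propositional, not definitional) agreement of the operations.
  module ListRepresentation (m : ℕ) (isSemiring : IsMPolySemiring m) where
    open CoefficientList (toSemiring m isSemiring) public

    ≋L⇒≈ₗ : ∀ {as bs} → as ≋L bs → as ≈ₗ bs
    ≋L⇒≈ₗ {[]}     {[]}     _       = []≈[]
    ≋L⇒≈ₗ {[]}     {b ∷ bs} (p , q) = []≈∷ ⟦ p ⟧ (≋L⇒≈ₗ q)
    ≋L⇒≈ₗ {a ∷ as} {[]}     (p , q) = ∷≈[] ⟦ p ⟧ (≋L⇒≈ₗ q)
    ≋L⇒≈ₗ {a ∷ as} {b ∷ bs} (p , q) = ∷-cong ⟦ p ⟧ (≋L⇒≈ₗ q)

    ≈ₗ⇒≋L : ∀ {as bs} → as ≈ₗ bs → as ≋L bs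
    ≈ₗ⇒≋L {[]}     {[]}     _ = tt
    ≈ₗ⇒≋L {[]}     {b ∷ bs} e = ≋-proof ([]≈∷-head e) , ≈ₗ⇒≋L ([]≈∷-tail e)
    ≈ₗ⇒≋L {a ∷ as} {[]}     e = ≋-proof (∷≈[]-head e) , ≈ₗ⇒≋L (∷≈[]-tail e)
    ≈ₗ⇒≋L {a ∷ as} {b ∷ bs} e = ≋-proof (∷-injectiveˡ e) , ≈ₗ⇒≋L (∷-injectiveʳ e)

    +L≡⊕ : ∀ as bs → as +L bs ≡ as ⊕ bs
    +L≡⊕ []       bs       = ≡.refl
    +L≡⊕ (a ∷ as) []       = ≡.refl
    +L≡⊕ (a ∷ as) (b ∷ bs) = ≡.cong ((a +P b) ∷_) (+L≡⊕ as bs)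

    scaleL≡scale : ∀ a bs → scaleL a bs ≡ scale a bs
    scaleL≡scale a []       = ≡.refl
    scaleL≡scale a (b ∷ bs) = ≡.cong ((a *P b) ∷_) (scaleL≡scale a bs)

    *L≡⊗ : ∀ as bs → as *L bs ≡ as ⊗ bs
    *L≡⊗ []       bs = ≡.refl
    *L≡⊗ (a ∷ as) bs = ≡.trans (+L≡⊕ (scaleL a bs) (zeroP ∷ (as *L bs)))
      (≡.cong₂ _⊕_ (scaleL≡scale a bs) (≡.cong (zeroP ∷_) (*L≡⊗ as bs)))

    ⟨⟩-resp : ∀ {as bs as' bs'} → as ≡ as' → bs ≡ bs' → as' ≈ₗ bs' → ⟨ as ⟩ ≈ₚ ⟨ bs ⟩
    ⟨⟩-resp ≡.refl ≡.refl e = ⟦ ≈ₗ⇒≋L e ⟧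

    private module L = IsCommutativeSemiring ⊕-⊗-isCommutativeSemiring

    isSemiring′ : IsMPolySemiring (suc m)
    isSemiring′ = IsCommutativeSemiringˡ.isCommutativeSemiring record
      { +-isCommutativeMonoid = record
        { isMonoid = record
          { isSemigroup = record
            { isMagma = record { isEquivalence = isEquivalence ; ∙-cong = +-cong }
            ; assoc = λ { ⟨ a ⟩ ⟨ b ⟩ ⟨ d ⟩ →
                ⟨⟩-resp (≡.trans (+L≡⊕ (a +L b) d) (≡.cong (_⊕ d) (+L≡⊕ a b)))
                        (≡.trans (+L≡⊕ a (b +L d)) (≡.cong (a ⊕_) (+L≡⊕ b d))) (L.+-assoc a b d) } }
          ; identity = (λ { ⟨ a ⟩ → ⟦ ≈ₗ⇒≋L ≈ₗ-refl ⟧ })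
                     , (λ { ⟨ a ⟩ → ⟨⟩-resp (+L≡⊕ a []) ≡.refl (L.+-identityʳ a) }) }
        ; comm = λ { ⟨ a ⟩ ⟨ b ⟩ → ⟨⟩-resp (+L≡⊕ a b) (+L≡⊕ b a) (L.+-comm a b) } }
      ; *-isCommutativeMonoid = record
        { isMonoid = record
          { isSemigroup = record
            { isMagma = record { isEquivalence = isEquivalence ; ∙-cong = *-cong }
            ; assoc = λ { ⟨ a ⟩ ⟨ b ⟩ ⟨ d ⟩ →
                ⟨⟩-resp (≡.trans (*L≡⊗ (a *L b) d) (≡.cong (_⊗ d) (*L≡⊗ a b)))
                        (≡.trans (*L≡⊗ a (b *L d)) (≡.cong (a ⊗_) (*L≡⊗ b d))) (L.*-assoc a b d) } }
          ; identity = (λ { ⟨ a ⟩ → ⟨⟩-resp (*L≡⊗ (oneP ∷ []) a) ≡.refl (L.*-identityˡ a) })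
                     , (λ { ⟨ a ⟩ → ⟨⟩-resp (*L≡⊗ a (oneP ∷ [])) ≡.refl (L.*-identityʳ a) }) }
        ; comm = λ { ⟨ a ⟩ ⟨ b ⟩ → ⟨⟩-resp (*L≡⊗ a b) (*L≡⊗ b a) (L.*-comm a b) } }
      ; distribʳ = λ { ⟨ a ⟩ ⟨ b ⟩ ⟨ d ⟩ →
          ⟨⟩-resp (≡.trans (*L≡⊗ (b +L d) a) (≡.cong (_⊗ a) (+L≡⊕ b d)))
                  (≡.trans (+L≡⊕ (b *L a) (d *L a)) (≡.cong₂ _⊕_ (*L≡⊗ b a) (*L≡⊗ d a)))
                  (L.distribʳ a b d) }
      ; zeroˡ = λ { ⟨ a ⟩ → ⟦ tt ⟧ } }
      where
      isEquivalence : IsEquivalence (_≈ₚ_ {suc m})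
      isEquivalence = record
        { refl  = λ { {⟨ a ⟩} → ⟦ ≈ₗ⇒≋L ≈ₗ-refl ⟧ }
        ; sym   = λ { {⟨ a ⟩} {⟨ b ⟩} ⟦ p ⟧ → ⟦ ≈ₗ⇒≋L (≈ₗ-sym (≋L⇒≈ₗ p)) ⟧ }
        ; trans = λ { {⟨ a ⟩} {⟨ b ⟩} {⟨ d ⟩} ⟦ p ⟧ ⟦ q ⟧ →
                        ⟦ ≈ₗ⇒≋L (≈ₗ-trans (≋L⇒≈ₗ p) (≋L⇒≈ₗ q)) ⟧ } }
      +-cong : ∀ {x y u v : MPoly (suc m)} → x ≈ₚ y → u ≈ₚ v → x +P u ≈ₚ y +P v
      +-cong {⟨ a ⟩} {⟨ b ⟩} {⟨ d ⟩} {⟨ e ⟩} ⟦ p ⟧ ⟦ q ⟧ =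
        ⟨⟩-resp (+L≡⊕ a d) (+L≡⊕ b e) (⊕-cong (≋L⇒≈ₗ p) (≋L⇒≈ₗ q))
      *-cong : ∀ {x y u v : MPoly (suc m)} → x ≈ₚ y → u ≈ₚ v → x *P u ≈ₚ y *P v
      *-cong {⟨ a ⟩} {⟨ b ⟩} {⟨ d ⟩} {⟨ e ⟩} ⟦ p ⟧ ⟦ q ⟧ =
        ⟨⟩-resp (*L≡⊗ a d) (*L≡⊗ b e) (⊗-cong (≋L⇒≈ₗ p) (≋L⇒≈ₗ q))

  isSemiring : ∀ m → IsMPolySemiring m
  isSemiring zero    = constants-isSemiring
  isSemiring (suc m) = ListRepresentation.isSemiring′ m (isSemiring m)

  semiring : ℕ → CommutativeSemiring c ℓ
  semiring m = toSemiring m (isSemiring m)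

  module MP {m : ℕ} = CommutativeSemiring (semiring m)
  module ≈ₚ-Reasoning {m : ℕ} = SetoidReasoning (MP.setoid {m})

module Substitution {c ℓ} (F : Field c ℓ) where
  open Poly F
  open PolynomialSemiring F
  open ≈ₚ-Reasoning
  private
    module 𝔽 = Field F
    module MP-* {m : ℕ} = CommutativeSemigroupProperties (MP.*-commutativeSemigroup {m})

  embed : ∀ {m} → MPoly m → MPoly (suc m)
  embed p = ⟨ p ∷ [] ⟩

  embed-cong : ∀ {m} {p q : MPoly m} → p ≈ₚ q → embed p ≈ₚ embed q
  embed-cong ⟦ e ⟧ = ⟦ e , tt ⟧

  embed-zero : ∀ {m} → embed (zeroP {m}) ≈ₚ zeroP
  embed-zero {m} = ⟦ ≋-proof (MP.refl {m} {zeroP}) , tt ⟧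

  embed-* : ∀ {m} (p q : MPoly m) → embed (p *P q) ≈ₚ embed p *P embed q
  embed-* p q = embed-cong (MP.sym (MP.+-identityʳ _))

  const-cong : ∀ {m a b} → a ≈ b → const {m} a ≈ₚ const b
  const-cong {zero}  e = ⟦ e ⟧
  const-cong {suc m} e = embed-cong (const-cong {m} e)

  const-0 : ∀ {m} → const {m} 0# ≈ₚ zeroP
  const-0 {zero}  = ⟦ 𝔽.refl ⟧
  const-0 {suc m} = ⟦ ≋-proof (const-0 {m}) , tt ⟧

  const-+ : ∀ {m} a b → const {m} (a + b) ≈ₚ const a +P const b
  const-+ {zero}  a b = ⟦ 𝔽.refl ⟧
  const-+ {suc m} a b = embed-cong (const-+ {m} a b)

  const-* : ∀ {m} a b → const {m} (a * b) ≈ₚ const a *P const b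
  const-* {zero}  a b = ⟦ 𝔽.refl ⟧
  const-* {suc m} a b = MP.trans (embed-cong (const-* {m} a b)) (embed-* (const a) (const b))

  ^P-congˡ : ∀ {m} {p q : MPoly m} → p ≈ₚ q → ∀ k → p ^P k ≈ₚ q ^P k
  ^P-congˡ e zero    = MP.refl
  ^P-congˡ e (suc k) = MP.*-cong e (^P-congˡ e k)

  ^P-distrib-* : ∀ {m} (p q : MPoly m) k → (p *P q) ^P k ≈ₚ (p ^P k) *P (q ^P k)
  ^P-distrib-* p q zero    = MP.sym (MP.*-identityˡ oneP)
  ^P-distrib-* p q (suc k) =
    MP.trans (MP.*-congˡ (^P-distrib-* p q k)) (MP-*.interchange p q (p ^P k) (q ^P k))

  subst-zero : ∀ {m m'} (σ : Fin m → MPoly m') → subst σ zeroP ≈ₚ zeroP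
  subst-zero {zero}  σ = const-0
  subst-zero {suc m} σ = MP.refl

  subst-const : ∀ {m m'} (σ : Fin m → MPoly m') a → subst σ (const a) ≈ₚ const a
  subst-const {zero}  σ a = MP.refl
  subst-const {suc m} σ a = begin
    subst (σ ∘ suc) (const a) +P σ zero *P zeroP ≈⟨ MP.+-cong (subst-const (σ ∘ suc) a) (MP.zeroʳ _) ⟩
    const a +P zeroP                            ≈⟨ MP.+-identityʳ _ ⟩
    const a                                     ∎

  subst-+ : ∀ {m m'} (σ : Fin m → MPoly m') p q → subst σ (p +P q) ≈ₚ subst σ p +P subst σ q
  substL-+ : ∀ {m m'} (σ : Fin (suc m) → MPoly m') as bs →
             substL σ (as +L bs) ≈ₚ substL σ as +P substL σ bs
  subst-+ σ (κ a)   (κ b)   = const-+ a b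
  subst-+ σ ⟨ as ⟩ ⟨ bs ⟩ = substL-+ σ as bs
  substL-+ σ []       bs       = MP.sym (MP.+-identityˡ _)
  substL-+ σ (a ∷ as) []       = MP.sym (MP.+-identityʳ _)
  substL-+ {m' = m'} σ (a ∷ as) (b ∷ bs) = begin
    subst (σ ∘ suc) (a +P b) +P y *P substL σ (as +L bs)
      ≈⟨ MP.+-cong (subst-+ (σ ∘ suc) a b) (MP.*-congˡ (substL-+ σ as bs)) ⟩
    (subst (σ ∘ suc) a +P subst (σ ∘ suc) b) +P y *P (substL σ as +P substL σ bs)
      ≈⟨ solve 5 (λ a b y u v → (a :+ b) :+ y :* (u :+ v) := (a :+ y :* u) :+ (b :+ y :* v)) MP.refl _ _ _ _ _ ⟩
    (subst (σ ∘ suc) a +P y *P substL σ as) +P (subst (σ ∘ suc) b +P y *P substL σ bs) ∎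
    where y = σ zero
          open Solver (semiring m')

  subst-* : ∀ {m m'} (σ : Fin m → MPoly m') p q → subst σ (p *P q) ≈ₚ subst σ p *P subst σ q
  substL-* : ∀ {m m'} (σ : Fin (suc m) → MPoly m') as bs →
             substL σ (as *L bs) ≈ₚ substL σ as *P substL σ bs
  substL-scaleL : ∀ {m m'} (σ : Fin (suc m) → MPoly m') a bs →
                  substL σ (scaleL a bs) ≈ₚ subst (σ ∘ suc) a *P substL σ bs
  subst-* σ (κ a)   (κ b)   = const-* a b
  subst-* σ ⟨ as ⟩ ⟨ bs ⟩ = substL-* σ as bs
  substL-* σ []       bs = MP.sym (MP.zeroˡ _)
  substL-* {m' = m'} σ (a ∷ as) bs = begin
    substL σ (scaleL a bs +L (zeroP ∷ (as *L bs)))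
      ≈⟨ substL-+ σ (scaleL a bs) (zeroP ∷ (as *L bs)) ⟩
    substL σ (scaleL a bs) +P (subst (σ ∘ suc) zeroP +P y *P substL σ (as *L bs))
      ≈⟨ MP.+-cong (substL-scaleL σ a bs) (MP.+-cong (subst-zero (σ ∘ suc)) (MP.*-congˡ (substL-* σ as bs))) ⟩
    subst (σ ∘ suc) a *P substL σ bs +P (zeroP +P y *P (substL σ as *P substL σ bs))
      ≈⟨ solve 4 (λ a b y u → a :* b :+ (con 0 :+ y :* (u :* b)) := (a :+ y :* u) :* b) MP.refl _ _ _ _ ⟩
    (subst (σ ∘ suc) a +P y *P substL σ as) *P substL σ bs ∎
    where y = σ zero
          open Solver (semiring m')
  substL-scaleL σ a []       = MP.sym (MP.zeroʳ _)
  substL-scaleL {m' = m'} σ a (b ∷ bs) = begin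
    subst (σ ∘ suc) (a *P b) +P y *P substL σ (scaleL a bs)
      ≈⟨ MP.+-cong (subst-* (σ ∘ suc) a b) (MP.*-congˡ (substL-scaleL σ a bs)) ⟩
    subst (σ ∘ suc) a *P subst (σ ∘ suc) b +P y *P (subst (σ ∘ suc) a *P substL σ bs)
      ≈⟨ solve 4 (λ a b y u → a :* b :+ y :* (a :* u) := a :* (b :+ y :* u)) MP.refl _ _ _ _ ⟩
    subst (σ ∘ suc) a *P (subst (σ ∘ suc) b +P y *P substL σ bs) ∎
    where y = σ zero
          open Solver (semiring m')

  subst-^P : ∀ {m m'} (σ : Fin m → MPoly m') p k → subst σ (p ^P k) ≈ₚ subst σ p ^P k
  subst-^P σ p zero    = subst-const σ 1#
  subst-^P σ p (suc k) = MP.trans (subst-* σ p (p ^P k)) (MP.*-congˡ (subst-^P σ p k))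

  subst-cong : ∀ {m m'} (σ : Fin m → MPoly m') {p q} → p ≈ₚ q → subst σ p ≈ₚ subst σ q
  substL-cong : ∀ {m m'} (σ : Fin (suc m) → MPoly m') {as bs} → as ≋L bs → substL σ as ≈ₚ substL σ bs
  substL-≈0 : ∀ {m m'} (σ : Fin (suc m) → MPoly m') {as} → as ≋L [] → substL σ as ≈ₚ zeroP
  subst-cong σ {κ a}   {κ b}   ⟦ e ⟧ = const-cong e
  subst-cong σ {⟨ as ⟩} {⟨ bs ⟩} ⟦ e ⟧ = substL-cong σ e
  substL-cong σ {[]}     {[]}     e = MP.refl
  substL-cong σ {[]}     {b ∷ bs} (e₁ , e₂) = MP.sym (substL-≈0 σ {b ∷ bs} (e₁ , flip e₂))
    where flip : ∀ {bs} → [] ≋L bs → bs ≋L []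
          flip {[]}     _       = tt
          flip {b ∷ bs} (p , q) = p , flip q
  substL-cong σ {a ∷ as} {[]}     e = substL-≈0 σ {a ∷ as} e
  substL-cong σ {a ∷ as} {b ∷ bs} (e₁ , e₂) =
    MP.+-cong (subst-cong (σ ∘ suc) {a} {b} ⟦ e₁ ⟧) (MP.*-congˡ (substL-cong σ e₂))
  substL-≈0 σ {[]}     _         = MP.refl
  substL-≈0 σ {a ∷ as} (e₁ , e₂) = begin
    subst (σ ∘ suc) a +P σ zero *P substL σ as
      ≈⟨ MP.+-cong (MP.trans (subst-cong (σ ∘ suc) {a} {zeroP} ⟦ e₁ ⟧) (subst-zero (σ ∘ suc)))
                   (MP.*-congˡ (substL-≈0 σ {as} e₂)) ⟩
    zeroP +P σ zero *P zeroP ≈⟨ MP.+-identityˡ _ ⟩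
    σ zero *P zeroP          ≈⟨ MP.zeroʳ _ ⟩
    zeroP                    ∎

  subst-ext : ∀ {m m'} {σ τ : Fin m → MPoly m'} → (∀ i → σ i ≈ₚ τ i) → ∀ p → subst σ p ≈ₚ subst τ p
  substL-ext : ∀ {m m'} {σ τ : Fin (suc m) → MPoly m'} → (∀ i → σ i ≈ₚ τ i) →
               ∀ as → substL σ as ≈ₚ substL τ as
  subst-ext e (κ a)   = MP.refl
  subst-ext e ⟨ as ⟩ = substL-ext e as
  substL-ext e []       = MP.refl
  substL-ext e (a ∷ as) = MP.+-cong (subst-ext (e ∘ suc) a) (MP.*-cong (e zero) (substL-ext e as))

  subst-subst : ∀ {m m' m''} (τ : Fin m' → MPoly m'') (σ : Fin m → MPoly m') p →
                subst τ (subst σ p) ≈ₚ subst (subst τ ∘ σ) p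
  substL-subst : ∀ {m m' m''} (τ : Fin m' → MPoly m'') (σ : Fin (suc m) → MPoly m') as →
                 subst τ (substL σ as) ≈ₚ substL (subst τ ∘ σ) as
  subst-subst τ σ (κ a)   = subst-const τ a
  subst-subst τ σ ⟨ as ⟩ = substL-subst τ σ as
  substL-subst τ σ []       = subst-zero τ
  substL-subst τ σ (a ∷ as) = begin
    subst τ (subst (σ ∘ suc) a +P σ zero *P substL σ as)
      ≈⟨ subst-+ τ (subst (σ ∘ suc) a) (σ zero *P substL σ as) ⟩
    subst τ (subst (σ ∘ suc) a) +P subst τ (σ zero *P substL σ as)
      ≈⟨ MP.+-cong (subst-subst τ (σ ∘ suc) a) (subst-* τ (σ zero) (substL σ as)) ⟩
    subst (subst τ ∘ σ ∘ suc) a +P subst τ (σ zero) *P subst τ (substL σ as)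
      ≈⟨ MP.+-congˡ (MP.*-congˡ (substL-subst τ σ as)) ⟩
    substL (subst τ ∘ σ) (a ∷ as) ∎

  subst-subst-comm : ∀ {m m₁ m₂ m'} (τ : Fin m₁ → MPoly m') (σ : Fin m → MPoly m₁)
                       (σ′ : Fin m₂ → MPoly m') (τ′ : Fin m → MPoly m₂) →
                     (∀ i → subst τ (σ i) ≈ₚ subst σ′ (τ′ i)) →
                     ∀ p → subst τ (subst σ p) ≈ₚ subst σ′ (subst τ′ p)
  subst-subst-comm τ σ σ′ τ′ e p = begin
    subst τ (subst σ p)      ≈⟨ subst-subst τ σ p ⟩
    subst (subst τ ∘ σ) p    ≈⟨ subst-ext e p ⟩
    subst (subst σ′ ∘ τ′) p  ≈⟨ MP.sym (subst-subst σ′ τ′ p) ⟩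
    subst σ′ (subst τ′ p)    ∎

  subst-var : ∀ {m m'} (σ : Fin m → MPoly m') i → subst σ (var i) ≈ₚ σ i
  subst-var {suc m} {m'} σ zero = begin
    subst (σ ∘ suc) zeroP +P σ zero *P (subst (σ ∘ suc) oneP +P σ zero *P zeroP)
      ≈⟨ MP.+-cong (subst-zero (σ ∘ suc)) (MP.*-congˡ (MP.+-congʳ (subst-const (σ ∘ suc) 1#))) ⟩
    zeroP +P σ zero *P (oneP +P σ zero *P zeroP)
      ≈⟨ solve 1 (λ y → con 0 :+ y :* (con 1 :+ y :* con 0) := y) MP.refl _ ⟩
    σ zero ∎
    where open Solver (semiring m')
  subst-var {suc m} σ (suc i) = begin
    subst (σ ∘ suc) (var i) +P σ zero *P zeroP ≈⟨ MP.+-congˡ (MP.zeroʳ _) ⟩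
    subst (σ ∘ suc) (var i) +P zeroP            ≈⟨ MP.+-identityʳ _ ⟩
    subst (σ ∘ suc) (var i)                     ≈⟨ subst-var (σ ∘ suc) i ⟩
    σ (suc i)                                   ∎

  subst-embed : ∀ {m m'} (τ : Fin m → MPoly m') p → subst (embed ∘ τ) p ≈ₚ embed (subst τ p)
  substL-embed : ∀ {m m'} (τ : Fin (suc m) → MPoly m') as →
                 substL (embed ∘ τ) as ≈ₚ embed (substL τ as)
  subst-embed τ (κ a)   = MP.refl
  subst-embed τ ⟨ as ⟩ = substL-embed τ as
  substL-embed τ []       = MP.sym embed-zero
  substL-embed τ (a ∷ as) = begin
    subst (embed ∘ τ ∘ suc) a +P embed (τ zero) *P substL (embed ∘ τ) as
      ≈⟨ MP.+-cong (subst-embed (τ ∘ suc) a) (MP.*-congˡ (substL-embed τ as)) ⟩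
    embed (subst (τ ∘ suc) a) +P embed (τ zero) *P embed (substL τ as)
      ≈⟨ MP.+-congˡ {x = embed (subst (τ ∘ suc) a)} (MP.sym (embed-* (τ zero) (substL τ as))) ⟩
    embed (subst (τ ∘ suc) a +P τ zero *P substL τ as) ∎

module Coefficients {c ℓ} (F : Field c ℓ) where
  open Poly F
  open PolynomialSemiring F
  open Substitution F
  open ≈ₚ-Reasoning

  coeffL-cong : ∀ {m} {as bs : List (MPoly m)} → as ≋L bs → ∀ j → coeffL as j ≈ₚ coeffL bs j
  coeffL-cong {as = []}     {[]}     _         j       = MP.refl
  coeffL-cong {as = []}     {b ∷ bs} (e₁ , e₂) zero    = MP.sym ⟦ e₁ ⟧
  coeffL-cong {as = []}     {b ∷ bs} (e₁ , e₂) (suc j) = coeffL-cong e₂ j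
  coeffL-cong {as = a ∷ as} {[]}     (e₁ , e₂) zero    = ⟦ e₁ ⟧
  coeffL-cong {as = a ∷ as} {[]}     (e₁ , e₂) (suc j) = coeffL-cong e₂ j
  coeffL-cong {as = a ∷ as} {b ∷ bs} (e₁ , e₂) zero    = ⟦ e₁ ⟧
  coeffL-cong {as = a ∷ as} {b ∷ bs} (e₁ , e₂) (suc j) = coeffL-cong e₂ j

  coeff-cong : ∀ {m} {p q : MPoly (suc m)} → p ≈ₚ q → ∀ j → coeff p j ≈ₚ coeff q j
  coeff-cong {p = ⟨ as ⟩} {⟨ bs ⟩} ⟦ e ⟧ = coeffL-cong e

  coeffL-ext : ∀ {m} {as bs : List (MPoly m)} → (∀ j → coeffL as j ≈ₚ coeffL bs j) → as ≋L bs
  coeffL-ext {as = []}     {[]}     e = tt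
  coeffL-ext {as = []}     {b ∷ bs} e = ≋-proof (MP.sym (e zero)) , coeffL-ext (e ∘ suc)
  coeffL-ext {as = a ∷ as} {[]}     e = ≋-proof (e zero) , coeffL-ext (e ∘ suc)
  coeffL-ext {as = a ∷ as} {b ∷ bs} e = ≋-proof (e zero) , coeffL-ext (e ∘ suc)

  coeff-ext : ∀ {m} {p q : MPoly (suc m)} → (∀ j → coeff p j ≈ₚ coeff q j) → p ≈ₚ q
  coeff-ext {p = ⟨ as ⟩} {⟨ bs ⟩} e = ⟦ coeffL-ext e ⟧

  coeffL-map : ∀ {m m'} (φ : MPoly m → MPoly m') → φ zeroP ≈ₚ zeroP →
               ∀ as j → coeffL (map φ as) j ≈ₚ φ (coeffL as j)
  coeffL-map φ φ0 []       j       = MP.sym φ0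
  coeffL-map φ φ0 (a ∷ as) zero    = MP.refl
  coeffL-map φ φ0 (a ∷ as) (suc j) = coeffL-map φ φ0 as j

  coeffL-+L : ∀ {m} (as bs : List (MPoly m)) j → coeffL (as +L bs) j ≈ₚ coeffL as j +P coeffL bs j
  coeffL-+L []       bs       j       = MP.sym (MP.+-identityˡ _)
  coeffL-+L (a ∷ as) []       j       = MP.sym (MP.+-identityʳ _)
  coeffL-+L (a ∷ as) (b ∷ bs) zero    = MP.refl
  coeffL-+L (a ∷ as) (b ∷ bs) (suc j) = coeffL-+L as bs j

  coeffL-scaleL : ∀ {m} (x : MPoly m) bs j → coeffL (scaleL x bs) j ≈ₚ x *P coeffL bs j
  coeffL-scaleL x []       j       = MP.sym (MP.zeroʳ x)
  coeffL-scaleL x (b ∷ bs) zero    = MP.refl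
  coeffL-scaleL x (b ∷ bs) (suc j) = coeffL-scaleL x bs j

  coeffL-[0] : ∀ {m} j → coeffL (zeroP {m} ∷ []) j ≈ₚ zeroP
  coeffL-[0] zero    = MP.refl
  coeffL-[0] (suc j) = MP.refl

  coeff-+P : ∀ {m} (p q : MPoly (suc m)) j → coeff (p +P q) j ≈ₚ coeff p j +P coeff q j
  coeff-+P ⟨ as ⟩ ⟨ bs ⟩ = coeffL-+L as bs

  coeff-embed-* : ∀ {m} (x : MPoly m) p j → coeff (embed x *P p) j ≈ₚ x *P coeff p j
  coeff-embed-* x ⟨ bs ⟩ j = begin
    coeffL (scaleL x bs +L (zeroP ∷ [])) j         ≈⟨ coeffL-+L (scaleL x bs) (zeroP ∷ []) j ⟩
    coeffL (scaleL x bs) j +P coeffL (zeroP ∷ []) j ≈⟨ MP.+-cong (coeffL-scaleL x bs j) (coeffL-[0] j) ⟩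
    x *P coeffL bs j +P zeroP                       ≈⟨ MP.+-identityʳ _ ⟩
    x *P coeffL bs j                                ∎

  coeff-var₀-*-zero : ∀ {m} (p : MPoly (suc m)) → coeff (var zero *P p) zero ≈ₚ zeroP
  coeff-var₀-*-zero ⟨ bs ⟩ = begin
    coeffL (scaleL zeroP bs +L (zeroP ∷ _)) zero ≈⟨ coeffL-+L (scaleL zeroP bs) (zeroP ∷ _) zero ⟩
    coeffL (scaleL zeroP bs) zero +P zeroP        ≈⟨ MP.+-identityʳ _ ⟩
    coeffL (scaleL zeroP bs) zero                 ≈⟨ coeffL-scaleL zeroP bs zero ⟩
    zeroP *P coeffL bs zero                       ≈⟨ MP.zeroˡ _ ⟩
    zeroP                                         ∎

  coeff-var₀-*-suc : ∀ {m} (p : MPoly (suc m)) j → coeff (var zero *P p) (suc j) ≈ₚ coeff p j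
  coeff-var₀-*-suc ⟨ bs ⟩ j = begin
    coeffL (scaleL zeroP bs +L (zeroP ∷ xs)) (suc j)
      ≈⟨ coeffL-+L (scaleL zeroP bs) (zeroP ∷ xs) (suc j) ⟩
    coeffL (scaleL zeroP bs) (suc j) +P coeffL xs j
      ≈⟨ MP.+-cong (MP.trans (coeffL-scaleL zeroP bs (suc j)) (MP.zeroˡ _)) (coeffL-+L (scaleL oneP bs) (zeroP ∷ []) j) ⟩
    zeroP +P (coeffL (scaleL oneP bs) j +P coeffL (zeroP ∷ []) j)
      ≈⟨ MP.+-identityˡ _ ⟩
    coeffL (scaleL oneP bs) j +P coeffL (zeroP ∷ []) j
      ≈⟨ MP.+-cong (MP.trans (coeffL-scaleL oneP bs j) (MP.*-identityˡ _)) (coeffL-[0] j) ⟩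
    coeffL bs j +P zeroP
      ≈⟨ MP.+-identityʳ _ ⟩
    coeffL bs j ∎
    where xs = scaleL oneP bs +L (zeroP ∷ [])

  coeff-subst : ∀ {m m'} (σ : Fin (suc m) → MPoly (suc m')) (τ : Fin m → MPoly m') (c : MPoly m') →
                σ zero ≈ₚ embed c *P var zero → (∀ i → σ (suc i) ≈ₚ embed (τ i)) →
                ∀ p j → coeff (subst σ p) j ≈ₚ c ^P j *P subst τ (coeff p j)
  coeff-subst σ τ c σ₀ σₛ ⟨ as ⟩ = coeffL-substL as
    where
    step : ∀ a as → substL σ (a ∷ as) ≈ₚ embed (subst τ a) +P embed c *P (var zero *P substL σ as)
    step a as = MP.+-cong (MP.trans (subst-ext σₛ a) (subst-embed τ a))
                         (MP.trans (MP.*-congʳ σ₀) (MP.*-assoc _ _ _))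
    coeffL-substL : ∀ as j → coeff (substL σ as) j ≈ₚ c ^P j *P subst τ (coeffL as j)
    coeffL-substL []       j = begin
      zeroP                      ≈⟨ MP.sym (MP.zeroʳ _) ⟩
      c ^P j *P zeroP            ≈⟨ MP.*-congˡ (MP.sym (subst-zero τ)) ⟩
      c ^P j *P subst τ zeroP    ∎
    coeffL-substL (a ∷ as) zero = begin
      coeff (substL σ (a ∷ as)) zero
        ≈⟨ coeff-cong (step a as) zero ⟩
      coeff (embed (subst τ a) +P embed c *P (var zero *P substL σ as)) zero
        ≈⟨ coeff-+P (embed (subst τ a)) (embed c *P (var zero *P substL σ as)) zero ⟩
      subst τ a +P coeff (embed c *P (var zero *P substL σ as)) zero
        ≈⟨ MP.+-congˡ (MP.trans (coeff-embed-* c (var zero *P substL σ as) zero)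
                         (MP.trans (MP.*-congˡ (coeff-var₀-*-zero (substL σ as))) (MP.zeroʳ c))) ⟩
      subst τ a +P zeroP
        ≈⟨ MP.trans (MP.+-identityʳ _) (MP.sym (MP.*-identityˡ _)) ⟩
      oneP *P subst τ a ∎
    coeffL-substL (a ∷ as) (suc j) = begin
      coeff (substL σ (a ∷ as)) (suc j)
        ≈⟨ coeff-cong (step a as) (suc j) ⟩
      coeff (embed (subst τ a) +P embed c *P (var zero *P substL σ as)) (suc j)
        ≈⟨ coeff-+P (embed (subst τ a)) (embed c *P (var zero *P substL σ as)) (suc j) ⟩
      zeroP +P coeff (embed c *P (var zero *P substL σ as)) (suc j)
        ≈⟨ MP.+-identityˡ _ ⟩
      coeff (embed c *P (var zero *P substL σ as)) (suc j)
        ≈⟨ coeff-embed-* c (var zero *P substL σ as) (suc j) ⟩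
      c *P coeff (var zero *P substL σ as) (suc j)
        ≈⟨ MP.*-congˡ (coeff-var₀-*-suc (substL σ as) j) ⟩
      c *P coeff (substL σ as) j
        ≈⟨ MP.*-congˡ (coeffL-substL as j) ⟩
      c *P (c ^P j *P subst τ (coeffL as j))
        ≈⟨ MP.sym (MP.*-assoc _ _ _) ⟩
      c ^P suc j *P subst τ (coeffL as j) ∎

  oneP-^P : ∀ {m} j → oneP {m} ^P j ≈ₚ oneP
  oneP-^P zero    = MP.refl
  oneP-^P (suc j) = MP.trans (MP.*-identityˡ _) (oneP-^P j)

  coeff-subst-fixing-y₀ : ∀ {m m'} (σ : Fin (suc m) → MPoly (suc m')) (τ : Fin m → MPoly m') →
                          σ zero ≈ₚ var zero → (∀ i → σ (suc i) ≈ₚ embed (τ i)) →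
                          ∀ p j → coeff (subst σ p) j ≈ₚ subst τ (coeff p j)
  coeff-subst-fixing-y₀ σ τ σ₀ σₛ p j = begin
    coeff (subst σ p) j           ≈⟨ coeff-subst σ τ oneP (MP.trans σ₀ (MP.sym (MP.*-identityˡ _))) σₛ p j ⟩
    oneP ^P j *P subst τ (coeff p j) ≈⟨ MP.trans (MP.*-congʳ (oneP-^P j)) (MP.*-identityˡ _) ⟩
    subst τ (coeff p j)           ∎

  All-coeffL : ∀ {a m} {Q : MPoly m → Set a} as → (∀ j → Q (coeffL as j)) → All Q as
  All-coeffL []       Q-coeff = []
  All-coeffL (a ∷ as) Q-coeff = Q-coeff zero ∷ All-coeffL as (Q-coeff ∘ suc)

module Evaluation {c ℓ} (F : Field c ℓ) where
  open Poly F
  open PolynomialSemiring F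
  open Substitution F
  private
    module 𝔽 = Field F
    module 𝔽-Reasoning = SetoidReasoning 𝔽.setoid

  origin : ∀ {m} → Fin m → MPoly zero
  origin _ = κ 0#

  eval₀ : ∀ {m} → MPoly m → MPoly zero
  eval₀ = subst origin

  unκ-cong : ∀ {x y : MPoly zero} → x ≈ₚ y → unκ x ≈ unκ y
  unκ-cong {κ a} {κ b} ⟦ e ⟧ = e

  unκ-+ : ∀ (x y : MPoly zero) → unκ (x +P y) ≈ unκ x + unκ y
  unκ-+ (κ a) (κ b) = 𝔽.refl

  unκ-* : ∀ (x y : MPoly zero) → unκ (x *P y) ≈ unκ x * unκ y
  unκ-* (κ a) (κ b) = 𝔽.refl

  κ-unκ : ∀ (x : MPoly zero) → x ≈ₚ κ (unκ x)
  κ-unκ (κ a) = MP.refl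

  at0-cong : ∀ {m} {p q : MPoly m} → p ≈ₚ q → at0 p ≈ at0 q
  at0-cong e = unκ-cong (subst-cong origin e)

  at0-+ : ∀ {m} (p q : MPoly m) → at0 (p +P q) ≈ at0 p + at0 q
  at0-+ p q = 𝔽.trans (unκ-cong (subst-+ origin p q)) (unκ-+ (eval₀ p) (eval₀ q))

  at0-* : ∀ {m} (p q : MPoly m) → at0 (p *P q) ≈ at0 p * at0 q
  at0-* p q = 𝔽.trans (unκ-cong (subst-* origin p q)) (unκ-* (eval₀ p) (eval₀ q))

  at0-const : ∀ {m} a → at0 (const {m} a) ≈ a
  at0-const {m} a = unκ-cong (subst-const {m} origin a)

  at0-zero : ∀ {m} → at0 (zeroP {m}) ≈ 0#
  at0-zero {m} = unκ-cong (subst-zero {m} origin)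

  at0-∷ : ∀ {m} (a : MPoly m) as → at0 ⟨ a ∷ as ⟩ ≈ at0 a
  at0-∷ a as = begin
    unκ (eval₀ a +P κ 0# *P substL origin as) ≈⟨ unκ-+ (eval₀ a) (κ 0# *P substL origin as) ⟩
    at0 a + unκ (κ 0# *P substL origin as)    ≈⟨ 𝔽.+-congˡ (unκ-* (κ 0#) (substL origin as)) ⟩
    at0 a + 0# * unκ (substL origin as)       ≈⟨ 𝔽.+-congˡ (𝔽.zeroˡ _) ⟩
    at0 a + 0#                                 ≈⟨ 𝔽.+-identityʳ _ ⟩
    at0 a                                      ∎
    where open 𝔽-Reasoning

  IsConstant : ∀ {m} → MPoly m → Set ℓ
  IsConstant p = p ≈ₚ const (at0 p)

  ≈const⇒IsConstant : ∀ {m} {p : MPoly m} {a} → p ≈ₚ const a → IsConstant p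
  ≈const⇒IsConstant {m} {p} {a} p≈a =
    MP.trans p≈a (const-cong (𝔽.sym (𝔽.trans (at0-cong p≈a) (at0-const {m} a))))

  IsConstant-+ : ∀ {m} {p q : MPoly m} → IsConstant p → IsConstant q → IsConstant (p +P q)
  IsConstant-+ {p = p} {q} p-const q-const =
    ≈const⇒IsConstant (MP.trans (MP.+-cong p-const q-const) (MP.sym (const-+ (at0 p) (at0 q))))

  IsConstant-* : ∀ {m} {p q : MPoly m} → IsConstant p → IsConstant q → IsConstant (p *P q)
  IsConstant-* {p = p} {q} p-const q-const =
    ≈const⇒IsConstant (MP.trans (MP.*-cong p-const q-const) (MP.sym (const-* (at0 p) (at0 q))))

  IsConstant-+-≈0 : ∀ {m} {p q : MPoly m} → IsConstant p → at0 q ≈ 0# → p +P q ≈ₚ zeroP → q ≈ₚ zeroP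
  IsConstant-+-≈0 {m} {p} {q} p-const q₀≈0 p+q≈0 = begin
    q                    ≈⟨ MP.sym (MP.+-identityˡ q) ⟩
    zeroP +P q           ≈⟨ MP.+-congʳ (MP.sym p≈0) ⟩
    p +P q               ≈⟨ p+q≈0 ⟩
    zeroP                ∎
    where
    open ≈ₚ-Reasoning
    p₀≈0 : at0 p ≈ 0#
    p₀≈0 = 𝔽.trans (𝔽.sym (𝔽.trans (at0-+ p q) (𝔽.trans (𝔽.+-congˡ q₀≈0) (𝔽.+-identityʳ _))))
                   (𝔽.trans (at0-cong p+q≈0) (at0-zero {m}))
    p≈0 : p ≈ₚ zeroP
    p≈0 = MP.trans p-const (MP.trans (const-cong p₀≈0) const-0)

  -- The lowest y₀-coefficient of f·g is f₀·g₀ with g₀(0) = g(0) ≠ 0, so f₀ = 0 by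
  -- induction on the number of variables; then repeat on the other coefficients of f.
  *-cancelʳ-≈0 : ∀ {m} (f g : MPoly m) → ¬ (at0 g ≈ 0#) → f *P g ≈ₚ zeroP → f ≈ₚ zeroP
  *L-cancelʳ-≈[] : ∀ {m} (g₀ : MPoly m) gs fs → ¬ (at0 g₀ ≈ 0#) → fs *L (g₀ ∷ gs) ≋L [] → fs ≋L []
  *-cancelʳ-≈0 (κ a) (κ b) b≉0 ⟦ ab≈0 ⟧ with 𝔽.inverse b b≉0
  ... | b⁻¹ , bb⁻¹≈1 = ⟦ begin
    a            ≈⟨ 𝔽.sym (𝔽.*-identityʳ a) ⟩
    a * 1#       ≈⟨ 𝔽.*-congˡ (𝔽.sym bb⁻¹≈1) ⟩
    a * (b * b⁻¹) ≈⟨ 𝔽.sym (𝔽.*-assoc a b b⁻¹) ⟩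
    a * b * b⁻¹  ≈⟨ 𝔽.*-congʳ ab≈0 ⟩
    0# * b⁻¹     ≈⟨ 𝔽.zeroˡ b⁻¹ ⟩
    0#           ∎ ⟧
    where open 𝔽-Reasoning
  *-cancelʳ-≈0 ⟨ fs ⟩ ⟨ [] ⟩      g≉0 _     = ⊥-elim (g≉0 𝔽.refl)
  *-cancelʳ-≈0 ⟨ fs ⟩ ⟨ g₀ ∷ gs ⟩ g≉0 ⟦ e ⟧ =
    ⟦ *L-cancelʳ-≈[] g₀ gs fs (g≉0 ∘ 𝔽.trans (at0-∷ g₀ gs)) e ⟧
  *L-cancelʳ-≈[] g₀ gs []        g₀≉0 _         = _
  *L-cancelʳ-≈[] {m} g₀ gs (f₀ ∷ fs) g₀≉0 (e₀ , e) =
    ≋-proof f₀≈0 , *L-cancelʳ-≈[] g₀ gs fs g₀≉0 (≈ₗ⇒≋L rest≈[])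
    where
    open ListRepresentation m (isSemiring m)
    f₀≈0 : f₀ ≈ₚ zeroP
    f₀≈0 = *-cancelʳ-≈0 f₀ g₀ g₀≉0 (MP.trans (MP.sym (MP.+-identityʳ _)) ⟦ e₀ ⟧)
    f₀gs≈[] : scaleL f₀ gs ≈ₗ []
    f₀gs≈[] = ≡.subst (_≈ₗ []) (≡.sym (scaleL≡scale f₀ gs)) (≈ₗ-trans (scale-cong f₀≈0 ≈ₗ-refl) (scale-0 gs))
    rest≈[] : fs *L (g₀ ∷ gs) ≈ₗ []
    rest≈[] = ≈ₗ-trans (≈ₗ-sym (⊕-congʳ (fs *L (g₀ ∷ gs)) f₀gs≈[]))
                       (≡.subst (_≈ₗ []) (+L≡⊕ (scaleL f₀ gs) (fs *L (g₀ ∷ gs))) (≋L⇒≈ₗ e))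

module Horner {c ℓ} (F : Field c ℓ) where
  open Poly F
  open PolynomialSemiring F
  open Substitution F
  open Evaluation F using (IsConstant; ≈const⇒IsConstant; IsConstant-+; IsConstant-*)
  open ≈ₚ-Reasoning

  horner : ∀ {m} → MPoly m → List (MPoly m) → MPoly m
  horner y []       = zeroP
  horner y (c ∷ cs) = c +P y *P horner y cs

  taylorQuotient : ∀ {m} → MPoly m → MPoly m → List (MPoly m) → MPoly m
  taylorQuotient y s []       = zeroP
  taylorQuotient y s (c ∷ cs) = horner y cs +P (y +P s) *P taylorQuotient y s cs

  horner-+ : ∀ {m} (y s : MPoly m) cs →
             horner (y +P s) cs ≈ₚ horner y cs +P s *P taylorQuotient y s cs
  horner-+ y s []       = MP.sym (MP.trans (MP.+-identityˡ _) (MP.zeroʳ s))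
  horner-+ {m} y s (c ∷ cs) = begin
    c +P (y +P s) *P horner (y +P s) cs
      ≈⟨ MP.+-congˡ (MP.*-congˡ (horner-+ y s cs)) ⟩
    c +P (y +P s) *P (horner y cs +P s *P taylorQuotient y s cs)
      ≈⟨ solve 5 (λ c y s h t → c :+ (y :+ s) :* (h :+ s :* t) := (c :+ y :* h) :+ s :* (h :+ (y :+ s) :* t))
               MP.refl c y s (horner y cs) (taylorQuotient y s cs) ⟩
    horner y (c ∷ cs) +P s *P taylorQuotient y s (c ∷ cs) ∎
    where open Solver (semiring m)

  horner-cong : ∀ {m} {y y' : MPoly m} {cs ds} → y ≈ₚ y' → Pointwise _≈ₚ_ cs ds →
                horner y cs ≈ₚ horner y' ds
  horner-cong y≈y' []             = MP.refl
  horner-cong y≈y' (c≈d ∷ cs≈ds) = MP.+-cong c≈d (MP.*-cong y≈y' (horner-cong y≈y' cs≈ds))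

  taylorQuotient-cong : ∀ {m} {y y' s s' : MPoly m} {cs ds} → y ≈ₚ y' → s ≈ₚ s' →
                        Pointwise _≈ₚ_ cs ds → taylorQuotient y s cs ≈ₚ taylorQuotient y' s' ds
  taylorQuotient-cong y≈y' s≈s' []             = MP.refl
  taylorQuotient-cong y≈y' s≈s' (c≈d ∷ cs≈ds) =
    MP.+-cong (horner-cong y≈y' cs≈ds) (MP.*-cong (MP.+-cong y≈y' s≈s') (taylorQuotient-cong y≈y' s≈s' cs≈ds))

  substL≡horner : ∀ {m m'} (σ : Fin (suc m) → MPoly m') as →
                  substL σ as ≡ horner (σ zero) (map (subst (σ ∘ suc)) as)
  substL≡horner σ []       = ≡.refl
  substL≡horner σ (a ∷ as) = ≡.cong (λ h → subst (σ ∘ suc) a +P σ zero *P h) (substL≡horner σ as)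

  subst-horner : ∀ {m m'} (σ : Fin m → MPoly m') y cs →
                 subst σ (horner y cs) ≈ₚ horner (subst σ y) (map (subst σ) cs)
  subst-horner σ y []       = subst-zero σ
  subst-horner σ y (c ∷ cs) = begin
    subst σ (c +P y *P horner y cs)                   ≈⟨ subst-+ σ c (y *P horner y cs) ⟩
    subst σ c +P subst σ (y *P horner y cs)           ≈⟨ MP.+-congˡ (subst-* σ y (horner y cs)) ⟩
    subst σ c +P subst σ y *P subst σ (horner y cs)   ≈⟨ MP.+-congˡ (MP.*-congˡ (subst-horner σ y cs)) ⟩
    horner (subst σ y) (map (subst σ) (c ∷ cs))       ∎

  subst-taylorQuotient : ∀ {m m'} (σ : Fin m → MPoly m') y s cs →
    subst σ (taylorQuotient y s cs) ≈ₚ taylorQuotient (subst σ y) (subst σ s) (map (subst σ) cs)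
  subst-taylorQuotient σ y s []       = subst-zero σ
  subst-taylorQuotient σ y s (c ∷ cs) = begin
    subst σ (horner y cs +P (y +P s) *P taylorQuotient y s cs)
      ≈⟨ subst-+ σ (horner y cs) ((y +P s) *P taylorQuotient y s cs) ⟩
    subst σ (horner y cs) +P subst σ ((y +P s) *P taylorQuotient y s cs)
      ≈⟨ MP.+-cong (subst-horner σ y cs) (subst-* σ (y +P s) (taylorQuotient y s cs)) ⟩
    horner (subst σ y) (map (subst σ) cs) +P subst σ (y +P s) *P subst σ (taylorQuotient y s cs)
      ≈⟨ MP.+-congˡ (MP.*-cong (subst-+ σ y s) (subst-taylorQuotient σ y s cs)) ⟩
    taylorQuotient (subst σ y) (subst σ s) (map (subst σ) (c ∷ cs)) ∎

  derivL : ∀ {m} → List (MPoly m) → List (MPoly m)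
  derivL []       = []
  derivL (a ∷ as) = derivFrom 1 as

  ∂₀≡derivL : ∀ {m} (as : List (MPoly m)) → ∂₀ ⟨ as ⟩ ≡ ⟨ derivL as ⟩
  ∂₀≡derivL []       = ≡.refl
  ∂₀≡derivL (a ∷ as) = ≡.refl

  horner-derivFrom-suc : ∀ {m} (y : MPoly m) i cs →
    horner y (derivFrom (suc i) cs) ≈ₚ horner y (derivFrom i cs) +P horner y cs
  horner-derivFrom-suc y i []       = MP.sym (MP.+-identityˡ zeroP)
  horner-derivFrom-suc {m} y i (c ∷ cs) = begin
    const (1# + natF i) *P c +P y *P horner y (derivFrom (suc (suc i)) cs)
      ≈⟨ MP.+-cong (MP.*-congʳ (const-+ 1# (natF i))) (MP.*-congˡ (horner-derivFrom-suc y (suc i) cs)) ⟩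
    (oneP +P n) *P c +P y *P (horner y (derivFrom (suc i) cs) +P horner y cs)
      ≈⟨ solve 5 (λ n c y d h → (con 1 :+ n) :* c :+ y :* (d :+ h) := (n :* c :+ y :* d) :+ (c :+ y :* h))
               MP.refl n c y (horner y (derivFrom (suc i) cs)) (horner y cs) ⟩
    horner y (derivFrom i (c ∷ cs)) +P horner y (c ∷ cs) ∎
    where n = const (natF i)
          open Solver (semiring m)

  taylorQuotient-zero : ∀ {m} (y : MPoly m) cs → taylorQuotient y zeroP cs ≈ₚ horner y (derivL cs)
  taylorQuotient-zero y []       = MP.refl
  taylorQuotient-zero {m} y (c ∷ cs) = begin
    horner y cs +P (y +P zeroP) *P taylorQuotient y zeroP cs
      ≈⟨ MP.+-congˡ (MP.*-cong (MP.+-identityʳ y) (taylorQuotient-zero y cs)) ⟩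
    horner y cs +P y *P horner y (derivL cs)
      ≈⟨ MP.sym (first-derivative cs) ⟩
    horner y (derivFrom 1 cs) ∎
    where
    first-derivative : ∀ cs → horner y (derivFrom 1 cs) ≈ₚ horner y cs +P y *P horner y (derivL cs)
    first-derivative []       = MP.sym (MP.trans (MP.+-identityˡ _) (MP.zeroʳ y))
    first-derivative (d ∷ ds) = begin
      horner y (derivFrom 1 (d ∷ ds))
        ≈⟨ horner-derivFrom-suc y 0 (d ∷ ds) ⟩
      (const 0# *P d +P y *P horner y (derivFrom 1 ds)) +P horner y (d ∷ ds)
        ≈⟨ MP.+-comm _ _ ⟩
      horner y (d ∷ ds) +P (const 0# *P d +P y *P horner y (derivFrom 1 ds))
        ≈⟨ MP.+-congˡ (MP.trans (MP.+-congʳ (MP.trans (MP.*-congʳ const-0) (MP.zeroˡ d))) (MP.+-identityˡ _)) ⟩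
      horner y (d ∷ ds) +P y *P horner y (derivL (d ∷ ds)) ∎

  subst-derivFrom : ∀ {m m'} (σ : Fin m → MPoly m') i as →
    Pointwise _≈ₚ_ (map (subst σ) (derivFrom i as)) (derivFrom i (map (subst σ) as))
  subst-derivFrom σ i []       = []
  subst-derivFrom σ i (a ∷ as) =
    MP.trans (subst-* σ (const (natF i)) a) (MP.*-congʳ (subst-const σ (natF i))) ∷ subst-derivFrom σ (suc i) as

  derivFrom-cong : ∀ {m} i {as bs : List (MPoly m)} → Pointwise _≈ₚ_ as bs →
                   Pointwise _≈ₚ_ (derivFrom i as) (derivFrom i bs)
  derivFrom-cong i []             = []
  derivFrom-cong i (a≈b ∷ as≈bs) = MP.*-congˡ a≈b ∷ derivFrom-cong (suc i) as≈bs

  derivL-cong : ∀ {m} {as bs : List (MPoly m)} → Pointwise _≈ₚ_ as bs → Pointwise _≈ₚ_ (derivL as) (derivL bs)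
  derivL-cong []             = []
  derivL-cong (_ ∷ as≈bs) = derivFrom-cong 1 as≈bs

  horner-IsConstant : ∀ {m} {y : MPoly m} {cs} → IsConstant y → All IsConstant cs → IsConstant (horner y cs)
  horner-IsConstant {m} y-const []                 = ≈const⇒IsConstant (MP.sym (const-0 {m}))
  horner-IsConstant     y-const (c-const ∷ cs-const) =
    IsConstant-+ c-const (IsConstant-* y-const (horner-IsConstant y-const cs-const))

  const*≈0 : ∀ {m} a (p : MPoly m) → p ≋ zeroP → const a *P p ≈ₚ zeroP
  const*≈0 a p p≋0 = MP.trans (MP.*-congˡ {x = const a} {p} {zeroP} ⟦ p≋0 ⟧) (MP.zeroʳ _)

  derivFrom-≋L : ∀ {m} i {as bs : List (MPoly m)} → as ≋L bs → derivFrom i as ≋L derivFrom i bs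
  derivFrom-≋L i {[]}     {[]}     _         = _
  derivFrom-≋L i {[]}     {b ∷ bs} (e₁ , e₂) = ≋-proof (const*≈0 (natF i) b e₁) , derivFrom-≋L (suc i) {[]} e₂
  derivFrom-≋L i {a ∷ as} {[]}     (e₁ , e₂) = ≋-proof (const*≈0 (natF i) a e₁) , derivFrom-≋L (suc i) {as} {[]} e₂
  derivFrom-≋L i {a ∷ as} {b ∷ bs} (e₁ , e₂) =
    ≋-proof (MP.*-congˡ {x = const (natF i)} {a} {b} ⟦ e₁ ⟧) , derivFrom-≋L (suc i) e₂

  ∂₀-cong : ∀ {m} {p q : MPoly (suc m)} → p ≈ₚ q → ∂₀ p ≈ₚ ∂₀ q
  ∂₀-cong {p = ⟨ [] ⟩}     {⟨ [] ⟩}     _           = MP.refl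
  ∂₀-cong {p = ⟨ [] ⟩}     {⟨ b ∷ bs ⟩} ⟦ _ , e ⟧ = ⟦ derivFrom-≋L 1 {[]} e ⟧
  ∂₀-cong {p = ⟨ a ∷ as ⟩} {⟨ [] ⟩}     ⟦ _ , e ⟧ = ⟦ derivFrom-≋L 1 {as} {[]} e ⟧
  ∂₀-cong {p = ⟨ a ∷ as ⟩} {⟨ b ∷ bs ⟩} ⟦ _ , e ⟧ = ⟦ derivFrom-≋L 1 e ⟧

  subst-derivL : ∀ {m m'} (σ : Fin m → MPoly m') as →
                 Pointwise _≈ₚ_ (map (subst σ) (derivL as)) (derivL (map (subst σ) as))
  subst-derivL σ []       = []
  subst-derivL σ (a ∷ as) = subst-derivFrom σ 1 as

module ApproximateRoots {c ℓ} (F : Field c ℓ) where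
  open Poly F
  open PolynomialSemiring F
  open Substitution F
  open Coefficients F
  open Evaluation F
  open Horner F
  open ≈ₚ-Reasoning
  private
    module 𝔽 = Field F
    module MP-* {m : ℕ} = CommutativeSemigroupProperties (MP.*-commutativeSemigroup {m})
    module MP-+ {m : ℕ} = CommutativeSemigroupProperties (MP.+-commutativeSemigroup {m})

  setT0 : ∀ {n} → MPoly (suc n) → MPoly (suc n)
  setT0 = subst atT0

  ConstantAtT0 : ∀ {n} → MPoly (suc n) → Set ℓ
  ConstantAtT0 p = setT0 p ≈ₚ const (at0 p)

  eval₀-setT0 : ∀ {n} (p : MPoly (suc n)) → eval₀ (setT0 p) ≈ₚ eval₀ p
  eval₀-setT0 {n} p = MP.trans (subst-subst origin atT0 p) (subst-ext eval₀-atT0 p)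
    where
    eval₀-atT0 : ∀ i → eval₀ (atT0 {n} i) ≈ₚ κ 0#
    eval₀-atT0 zero    = subst-zero {suc n} origin
    eval₀-atT0 (suc i) = subst-var origin (suc i)

  at0-setT0 : ∀ {n} (p : MPoly (suc n)) → at0 (setT0 p) ≈ at0 p
  at0-setT0 p = unκ-cong (eval₀-setT0 p)

  ≈const⇒ConstantAtT0 : ∀ {n} {p : MPoly (suc n)} {a} → setT0 p ≈ₚ const a → ConstantAtT0 p
  ≈const⇒ConstantAtT0 {n} {p} {a} p₀≈a = MP.trans p₀≈a (const-cong a≈p₀)
    where
    a≈p₀ : a ≈ at0 p
    a≈p₀ = 𝔽.trans (𝔽.sym (at0-const {suc n} a)) (𝔽.trans (𝔽.sym (at0-cong p₀≈a)) (at0-setT0 p))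

  -- P(0, x, z) ∈ F[z] says exactly that each coefficient of P in z is constant at T = 0.
  TRegularized⇒ConstantAtT0 : ∀ {n} (ps : List (MPoly (suc n))) → TRegularized ⟨ ps ⟩ → All ConstantAtT0 ps
  TRegularized⇒ConstantAtT0 {n} ps (q , P₀≋q) = All-coeffL ps λ j → ≈const⇒ConstantAtT0 {p = coeffL ps j} (begin
    setT0 (coeffL ps j)          ≈⟨ MP.sym (coeff-subst-fixing-y₀ atT0z atT0 MP.refl lift ⟨ ps ⟩ j) ⟩
    coeff (subst atT0z ⟨ ps ⟩) j ≈⟨ coeff-cong {p = subst atT0z ⟨ ps ⟩} {subst ιz q} ⟦ P₀≋q ⟧ j ⟩
    coeff (subst ιz q) j         ≈⟨ coeff-subst-fixing-y₀ ιz (λ ()) MP.refl (λ ()) q j ⟩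
    subst (λ ()) (coeff q j)     ≈⟨ constant (coeff q j) ⟩
    const (unκ (coeff q j))      ∎)
    where
    lift : ∀ i → atT0z {n} (suc i) ≈ₚ embed (atT0 i)
    lift zero    = MP.sym embed-zero
    lift (suc i) = MP.refl
    constant : ∀ x → subst {m' = suc n} (λ ()) x ≈ₚ const (unκ x)
    constant (κ a) = MP.refl

  setT0-approxRoot : ∀ {n} ps (R : MPoly (suc n)) k Q →
    subst (plugZ R) ⟨ ps ⟩ ≈ₚ var zero ^P suc k *P Q → horner (setT0 R) (map setT0 ps) ≈ₚ zeroP
  setT0-approxRoot {n} ps R k Q root = begin
    horner (setT0 R) (map setT0 ps)        ≡⟨ ≡.sym (substL≡horner ρ ps) ⟩
    subst ρ ⟨ ps ⟩                         ≈⟨ MP.sym (subst-ext plug-setT0 ⟨ ps ⟩) ⟩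
    subst (setT0 ∘ plugZ R) ⟨ ps ⟩         ≈⟨ MP.sym (subst-subst atT0 (plugZ R) ⟨ ps ⟩) ⟩
    setT0 (subst (plugZ R) ⟨ ps ⟩)         ≈⟨ subst-cong atT0 root ⟩
    setT0 (var zero *P var zero ^P k *P Q) ≈⟨ subst-* atT0 (var zero *P var zero ^P k) Q ⟩
    setT0 (var zero *P var zero ^P k) *P setT0 Q
      ≈⟨ MP.*-congʳ (MP.trans (subst-* atT0 (var zero) (var zero ^P k)) (MP.*-congʳ (subst-var atT0 zero))) ⟩
    zeroP *P setT0 (var zero ^P k) *P setT0 Q
      ≈⟨ MP.trans (MP.*-congʳ (MP.zeroˡ _)) (MP.zeroˡ _) ⟩
    zeroP ∎
    where
    ρ : Fin (suc (suc n)) → MPoly (suc n)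
    ρ zero    = setT0 R
    ρ (suc i) = atT0 i
    plug-setT0 : ∀ i → setT0 (plugZ R i) ≈ₚ ρ i
    plug-setT0 zero    = MP.refl
    plug-setT0 (suc i) = subst-var atT0 i

  subst-evalAt-∂₀ : ∀ {n} r (ps : List (MPoly (suc n))) →
                    subst (evalAt r) (∂₀ ⟨ ps ⟩) ≈ₚ horner (κ r) (derivL (map eval₀ ps))
  subst-evalAt-∂₀ r ps = begin
    subst (evalAt r) (∂₀ ⟨ ps ⟩)          ≡⟨ ≡.cong (subst (evalAt r)) (∂₀≡derivL ps) ⟩
    substL (evalAt r) (derivL ps)          ≡⟨ substL≡horner (evalAt r) (derivL ps) ⟩
    horner (κ r) (map eval₀ (derivL ps))   ≈⟨ horner-cong MP.refl (subst-derivL origin ps) ⟩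
    horner (κ r) (derivL (map eval₀ ps))   ∎

  at0-taylorQuotient : ∀ {n} (ps : List (MPoly (suc n))) r S → at0 S ≈ 0# →
    at0 (taylorQuotient (const r) S (map setT0 ps)) ≈ unκ (subst (evalAt r) (∂₀ ⟨ ps ⟩))
  at0-taylorQuotient {n} ps r S S₀≈0 = unκ-cong (begin
    eval₀ (taylorQuotient (const r) S (map setT0 ps))
      ≈⟨ subst-taylorQuotient origin (const r) S (map setT0 ps) ⟩
    taylorQuotient (eval₀ (const {suc n} r)) (eval₀ S) (map eval₀ (map setT0 ps))
      ≈⟨ taylorQuotient-cong (subst-const {suc n} origin r) (MP.trans (κ-unκ (eval₀ S)) ⟦ S₀≈0 ⟧)
                             (eval₀-setT0-map ps) ⟩
    taylorQuotient (κ r) zeroP (map eval₀ ps)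
      ≈⟨ taylorQuotient-zero (κ r) (map eval₀ ps) ⟩
    horner (κ r) (derivL (map eval₀ ps))
      ≈⟨ MP.sym (subst-evalAt-∂₀ r ps) ⟩
    subst (evalAt r) (∂₀ ⟨ ps ⟩) ∎)
    where
    eval₀-setT0-map : ∀ ps → Pointwise _≈ₚ_ (map eval₀ (map setT0 ps)) (map eval₀ ps)
    eval₀-setT0-map []       = []
    eval₀-setT0-map (p ∷ ps) = eval₀-setT0 p ∷ eval₀-setT0-map ps

  setT0-root-constant : ∀ {n} ps (R : MPoly (suc n)) → All ConstantAtT0 ps → NonDegenerate ⟨ ps ⟩ R →
                        horner (setT0 R) (map setT0 ps) ≈ₚ zeroP → ConstantAtT0 R
  setT0-root-constant {n} ps R ps-const nondeg root = begin
    setT0 R           ≈⟨ R₀≈r+S ⟩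
    const r +P S      ≈⟨ MP.+-congˡ S≈0 ⟩
    const r +P zeroP  ≈⟨ MP.+-identityʳ _ ⟩
    const r           ∎
    where
    r = at0 R
    S = setT0 R +P const (𝔽.- r)
    cs = map setT0 ps
    D = taylorQuotient (const r) S cs
    S₀≈0 : at0 S ≈ 0#
    S₀≈0 = 𝔽.trans (at0-+ (setT0 R) (const (𝔽.- r)))
                   (𝔽.trans (𝔽.+-cong (at0-setT0 R) (at0-const {suc n} (𝔽.- r))) (𝔽.-‿inverseʳ r))
    R₀≈r+S : setT0 R ≈ₚ const r +P S
    R₀≈r+S = begin
      setT0 R                             ≈⟨ MP.sym (MP.+-identityʳ _) ⟩
      setT0 R +P zeroP                    ≈⟨ MP.+-congˡ (MP.sym (MP.trans (const-cong (𝔽.-‿inverseʳ r)) const-0)) ⟩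
      setT0 R +P const (r + 𝔽.- r)          ≈⟨ MP.+-congˡ (const-+ r (𝔽.- r)) ⟩
      setT0 R +P (const r +P const (𝔽.- r)) ≈⟨ MP-+.x∙yz≈y∙xz (setT0 R) (const r) (const (𝔽.- r)) ⟩
      const r +P S                        ∎
    expansion : horner (const r) cs +P S *P D ≈ₚ zeroP
    expansion = MP.trans (MP.sym (horner-+ (const r) S cs))
                         (MP.trans (horner-cong {cs = cs} (MP.sym R₀≈r+S) (Pointwise.refl MP.refl)) root)
    cs-const : ∀ {ps} → All ConstantAtT0 ps → All IsConstant (map setT0 ps)
    cs-const []                 = []
    cs-const (p-const ∷ ps-const) = ≈const⇒IsConstant p-const ∷ cs-const ps-const
    S*D≈0 : S *P D ≈ₚ zeroP
    S*D≈0 = IsConstant-+-≈0 (horner-IsConstant (≈const⇒IsConstant MP.refl) (cs-const ps-const))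
                            (𝔽.trans (at0-* S D) (𝔽.trans (𝔽.*-congʳ S₀≈0) (𝔽.zeroˡ _))) expansion
    D₀≉0 : ¬ (at0 D ≈ 0#)
    D₀≉0 D₀≈0 = nondeg (𝔽.trans (𝔽.sym (at0-taylorQuotient ps r S S₀≈0)) D₀≈0)
    S≈0 : S ≈ₚ zeroP
    S≈0 = *-cancelʳ-≈0 S D D₀≉0 S*D≈0

  module _ {n μ : ℕ} (h : Fin n → MPoly μ) (γ : Carrier) where

    setT0-ΛTx : ∀ p → setT0 (ΛTx h γ p) ≈ₚ ΛTx h γ (setT0 p)
    setT0-ΛTx = subst-subst-comm atT0 (ΛTxσ h γ) (ΛTxσ h γ) atT0 commute
      where
      commute : ∀ i → setT0 (ΛTxσ h γ i) ≈ₚ ΛTx h γ (atT0 i)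
      commute zero    = begin
        setT0 (const γ *P var zero)          ≈⟨ subst-* atT0 (const γ) (var zero) ⟩
        setT0 (const γ) *P setT0 (var zero) ≈⟨ MP.*-congˡ (subst-var atT0 zero) ⟩
        setT0 (const γ) *P zeroP            ≈⟨ MP.zeroʳ _ ⟩
        zeroP                                ≈⟨ MP.sym (subst-zero (ΛTxσ h γ)) ⟩
        ΛTx h γ zeroP                        ∎
      commute (suc i) = begin
        setT0 (subst (var ∘ suc) (h i))      ≈⟨ subst-subst atT0 (var ∘ suc) (h i) ⟩
        subst (setT0 ∘ var ∘ suc) (h i)      ≈⟨ subst-ext (subst-var atT0 ∘ suc) (h i) ⟩
        subst (var ∘ suc) (h i)              ≈⟨ MP.sym (subst-var (ΛTxσ h γ) (suc i)) ⟩
        ΛTx h γ (var (suc i))                ∎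

    setT0-ΛTx-const : ∀ p → ConstantAtT0 p → setT0 (ΛTx h γ p) ≈ₚ const (at0 p)
    setT0-ΛTx-const p p-const = begin
      setT0 (ΛTx h γ p)                 ≈⟨ setT0-ΛTx p ⟩
      ΛTx h γ (setT0 p)                 ≈⟨ subst-cong (ΛTxσ h γ) p-const ⟩
      ΛTx h γ (const (at0 p))           ≈⟨ subst-const (ΛTxσ h γ) (at0 p) ⟩
      const (at0 p)                     ∎

    eval₀-ΛTx : ∀ p → ConstantAtT0 p → eval₀ (ΛTx h γ p) ≈ₚ eval₀ p
    eval₀-ΛTx p p-const = begin
      eval₀ (ΛTx h γ p)                 ≈⟨ MP.sym (eval₀-setT0 (ΛTx h γ p)) ⟩
      eval₀ (setT0 (ΛTx h γ p))         ≈⟨ subst-cong origin (setT0-ΛTx-const p p-const) ⟩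
      eval₀ (const {suc μ} (at0 p))     ≈⟨ subst-const {suc μ} origin (at0 p) ⟩
      κ (at0 p)                         ≈⟨ MP.sym (κ-unκ (eval₀ p)) ⟩
      eval₀ p                           ∎

    ΛTxz-coefficients : ∀ P j → coeff (ΛTxz h γ P) j ≈ₚ ΛTx h γ (coeff P j)
    ΛTxz-coefficients = coeff-subst-fixing-y₀ (ΛTxzσ h γ) (ΛTxσ h γ) MP.refl lift
      where
      lift : ∀ i → ΛTxzσ h γ (suc i) ≈ₚ embed (ΛTxσ h γ i)
      lift zero    = MP.sym (embed-* (const γ) (var zero))
      lift (suc i) = subst-embed (var ∘ suc) (h i)

    ΛTxz-preserves-MonicZ : ∀ P → MonicZ P → MonicZ (ΛTxz h γ P)
    ΛTxz-preserves-MonicZ P (d , a , a≉0 , lead , above) = d , a , a≉0 ,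
      ≋-proof (begin
        coeff (ΛTxz h γ P) d      ≈⟨ ΛTxz-coefficients P d ⟩
        ΛTx h γ (coeff P d)       ≈⟨ subst-cong (ΛTxσ h γ) {coeff P d} {const a} ⟦ lead ⟧ ⟩
        ΛTx h γ (const a)         ≈⟨ subst-const (ΛTxσ h γ) a ⟩
        const a                   ∎) ,
      λ i d<i → ≋-proof (begin
        coeff (ΛTxz h γ P) i      ≈⟨ ΛTxz-coefficients P i ⟩
        ΛTx h γ (coeff P i)       ≈⟨ subst-cong (ΛTxσ h γ) {coeff P i} {zeroP} ⟦ above i d<i ⟧ ⟩
        ΛTx h γ zeroP             ≈⟨ subst-zero (ΛTxσ h γ) ⟩
        zeroP                     ∎)

    ΛTx-preserves-Truncated : ∀ R k → Truncated R k → Truncated (ΛTx h γ R) k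
    ΛTx-preserves-Truncated R k R-trunc j k≤j = ≋-proof (begin
      coeff (ΛTx h γ R) j                  ≈⟨ coeff-subst (ΛTxσ h γ) τ (const γ) MP.refl τ-lift R j ⟩
      const γ ^P j *P subst τ (coeff R j)  ≈⟨ MP.*-congˡ (subst-cong τ {coeff R j} {zeroP} ⟦ R-trunc j k≤j ⟧) ⟩
      const γ ^P j *P subst τ zeroP        ≈⟨ MP.*-congˡ (subst-zero τ) ⟩
      const γ ^P j *P zeroP                ≈⟨ MP.zeroʳ _ ⟩
      zeroP                                ∎)
      where
      τ : Fin n → MPoly μ
      τ = subst var ∘ h
      τ-lift : ∀ i → ΛTxσ h γ (suc i) ≈ₚ embed (τ i)
      τ-lift i = subst-embed var (h i)

    ΛTxz-preserves-TRegularized : ∀ P → TRegularized P → TRegularized (ΛTxz h γ P)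
    ΛTxz-preserves-TRegularized P (q , P₀≋q) = q , ≋-proof (begin
      subst atT0z (ΛTxz h γ P)                 ≈⟨ subst-subst-comm atT0z (ΛTxzσ h γ) (ΛTxzσ h γ) atT0z commute P ⟩
      ΛTxz h γ (subst atT0z P)                 ≈⟨ subst-cong (ΛTxzσ h γ) {subst atT0z P} {subst ιz q} ⟦ P₀≋q ⟧ ⟩
      ΛTxz h γ (subst ιz q)                    ≈⟨ subst-subst (ΛTxzσ h γ) ιz q ⟩
      subst (ΛTxz h γ ∘ ιz) q                  ≈⟨ subst-ext fixes-z q ⟩
      subst ιz q                               ∎)
      where
      commute : ∀ i → subst atT0z (ΛTxzσ h γ i) ≈ₚ ΛTxz h γ (atT0z i)
      commute zero             = MP.trans (subst-var atT0z zero) (MP.sym (subst-var (ΛTxzσ h γ) zero))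
      commute (suc zero)       = begin
        subst atT0z (const γ *P var (suc zero))
          ≈⟨ subst-* atT0z (const γ) (var (suc zero)) ⟩
        subst atT0z (const γ) *P subst atT0z (var (suc zero))
          ≈⟨ MP.*-congˡ (subst-var atT0z (suc zero)) ⟩
        subst atT0z (const γ) *P zeroP
          ≈⟨ MP.zeroʳ _ ⟩
        zeroP
          ≈⟨ MP.sym (subst-zero (ΛTxzσ h γ)) ⟩
        ΛTxz h γ zeroP ∎
      commute (suc (suc i)) = begin
        subst atT0z (subst (λ j → var (suc (suc j))) (h i))   ≈⟨ subst-subst atT0z (λ j → var (suc (suc j))) (h i) ⟩
        subst (λ j → subst atT0z (var (suc (suc j)))) (h i)   ≈⟨ subst-ext (λ j → subst-var atT0z (suc (suc j))) (h i) ⟩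
        subst (λ j → var (suc (suc j))) (h i)                 ≈⟨ MP.sym (subst-var (ΛTxzσ h γ) (suc (suc i))) ⟩
        ΛTxz h γ (var (suc (suc i)))                  ∎
      fixes-z : ∀ i → ΛTxz h γ (ιz {n} i) ≈ₚ ιz {μ} i
      fixes-z zero = subst-var (ΛTxzσ h γ) zero

    -- Λ(P)(T, w, Λ(R)) = Λ(P(T, x, R)) = Λ(T^k Q) = T^k (γ^k Λ(Q)).
    ΛTxz-preserves-ApproxRoot : ∀ P R k → ApproxRoot P R k → ApproxRoot (ΛTxz h γ P) (ΛTx h γ R) k
    ΛTxz-preserves-ApproxRoot P R k (Q , P[R]≋TᵏQ) = const γ ^P k *P ΛTx h γ Q , ≋-proof (begin
      subst (plugZ R′) (ΛTxz h γ P)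
        ≈⟨ subst-subst-comm (plugZ R′) (ΛTxzσ h γ) (ΛTxσ h γ) (plugZ R) commute P ⟩
      ΛTx h γ (subst (plugZ R) P)
        ≈⟨ subst-cong (ΛTxσ h γ) {subst (plugZ R) P} {var zero ^P k *P Q} ⟦ P[R]≋TᵏQ ⟧ ⟩
      ΛTx h γ (var zero ^P k *P Q)
        ≈⟨ subst-* (ΛTxσ h γ) (var zero ^P k) Q ⟩
      ΛTx h γ (var zero ^P k) *P ΛTx h γ Q
        ≈⟨ MP.*-congʳ (MP.trans (subst-^P (ΛTxσ h γ) (var zero) k) (^P-congˡ (subst-var (ΛTxσ h γ) zero) k)) ⟩
      (const γ *P var zero) ^P k *P ΛTx h γ Q
        ≈⟨ MP.*-congʳ (^P-distrib-* (const γ) (var zero) k) ⟩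
      (const γ ^P k *P var zero ^P k) *P ΛTx h γ Q
        ≈⟨ MP-*.xy∙z≈y∙xz _ _ _ ⟩
      var zero ^P k *P (const γ ^P k *P ΛTx h γ Q) ∎)
      where
      R′ = ΛTx h γ R
      commute : ∀ i → subst (plugZ R′) (ΛTxzσ h γ i) ≈ₚ ΛTx h γ (plugZ R i)
      commute zero          = subst-var (plugZ R′) zero
      commute (suc zero)    = begin
        subst (plugZ R′) (const γ *P var (suc zero))
          ≈⟨ subst-* (plugZ R′) (const γ) (var (suc zero)) ⟩
        subst (plugZ R′) (const γ) *P subst (plugZ R′) (var (suc zero))
          ≈⟨ MP.*-cong (subst-const (plugZ R′) γ) (subst-var (plugZ R′) (suc zero)) ⟩
        const γ *P var zero
          ≈⟨ MP.sym (subst-var (ΛTxσ h γ) zero) ⟩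
        ΛTx h γ (var zero) ∎
      commute (suc (suc i)) = begin
        subst (plugZ R′) (subst (λ j → var (suc (suc j))) (h i))
          ≈⟨ subst-subst (plugZ R′) (λ j → var (suc (suc j))) (h i) ⟩
        subst (λ j → subst (plugZ R′) (var (suc (suc j)))) (h i)
          ≈⟨ subst-ext (λ j → subst-var (plugZ R′) (suc (suc j))) (h i) ⟩
        subst (var ∘ suc) (h i)
          ≈⟨ MP.sym (subst-var (ΛTxσ h γ) (suc i)) ⟩
        ΛTx h γ (var (suc i)) ∎


    ΛTxz-preserves-NonDegenerate : ∀ ps R → All ConstantAtT0 ps → at0 (ΛTx h γ R) ≈ at0 R →
                                   NonDegenerate ⟨ ps ⟩ R → NonDegenerate (ΛTxz h γ ⟨ ps ⟩) (ΛTx h γ R)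
    ΛTxz-preserves-NonDegenerate ps R ps-const r′≈r nondeg v≈0 =
      nondeg (𝔽.trans (𝔽.sym (unκ-cong same-value)) v≈0)
      where
      r = at0 R
      r′ = at0 (ΛTx h γ R)
      ΛP≈ : ΛTxz h γ ⟨ ps ⟩ ≈ₚ ⟨ map (ΛTx h γ) ps ⟩
      ΛP≈ = coeff-ext λ j → MP.trans (ΛTxz-coefficients ⟨ ps ⟩ j)
                                     (MP.sym (coeffL-map (ΛTx h γ) (subst-zero (ΛTxσ h γ)) ps j))
      eval₀-map : ∀ {ps} → All ConstantAtT0 ps → Pointwise _≈ₚ_ (map eval₀ (map (ΛTx h γ) ps)) (map eval₀ ps)
      eval₀-map         []                   = []
      eval₀-map {p ∷ _} (p-const ∷ ps-const) = eval₀-ΛTx p p-const ∷ eval₀-map ps-const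
      same-value : subst (evalAt r′) (∂₀ (ΛTxz h γ ⟨ ps ⟩)) ≈ₚ subst (evalAt r) (∂₀ ⟨ ps ⟩)
      same-value = begin
        subst (evalAt r′) (∂₀ (ΛTxz h γ ⟨ ps ⟩))
          ≈⟨ subst-cong (evalAt r′) (∂₀-cong ΛP≈) ⟩
        subst (evalAt r′) (∂₀ ⟨ map (ΛTx h γ) ps ⟩)
          ≈⟨ subst-evalAt-∂₀ r′ (map (ΛTx h γ) ps) ⟩
        horner (κ r′) (derivL (map eval₀ (map (ΛTx h γ) ps)))
          ≈⟨ horner-cong ⟦ r′≈r ⟧ (derivL-cong (eval₀-map ps-const)) ⟩
        horner (κ r) (derivL (map eval₀ ps))
          ≈⟨ MP.sym (subst-evalAt-∂₀ r ps) ⟩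
        subst (evalAt r) (∂₀ ⟨ ps ⟩) ∎

open Poly using (⟨_⟩)

lemma6p1 : ∀ {c ℓ} (F : Field c ℓ) → let open Poly F in
    (n μ k : ℕ) → 1 < k →
    (P : MPoly (suc (suc n))) (R : MPoly (suc n)) →
    TRegularized P → MonicZ P → TNDApproxRoot P R k →
    (h : Fin n → MPoly μ) (γ : Carrier) → ¬ (γ ≈ 0#) →
      (∃ λ (r : Carrier) →
         (subst atT0 R ≋ const r) × (subst atT0 (ΛTx h γ R) ≋ const r))
      × (TRegularized (ΛTxz h γ P) × MonicZ (ΛTxz h γ P))
      × TNDApproxRoot (ΛTxz h γ P) (ΛTx h γ R) k
lemma6p1 F n μ (suc k) _ P@(⟨ ps ⟩) R P-reg P-monic (R-trunc , R-nondeg , Q , root) h γ _ =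
    (at0 R , ≋-proof R-const , ≋-proof (setT0-ΛTx-const h γ R R-const))
  , (ΛTxz-preserves-TRegularized h γ P P-reg , ΛTxz-preserves-MonicZ h γ P P-monic)
  , ( ΛTx-preserves-Truncated h γ R (suc k) R-trunc
    , ΛTxz-preserves-NonDegenerate h γ ps R ps-const (unκ-cong (eval₀-ΛTx h γ R R-const)) R-nondeg
    , ΛTxz-preserves-ApproxRoot h γ P R (suc k) (Q , root))
  where
  open Poly F
  open PolynomialSemiring F
  open Evaluation F
  open ApproximateRoots F
  ps-const : All ConstantAtT0 ps
  ps-const = TRegularized⇒ConstantAtT0 ps P-reg
  R-const : ConstantAtT0 R
  R-const = setT0-root-constant ps R ps-const R-nondeg (setT0-approxRoot ps R k Q ⟦ root ⟧)
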